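{- Let $p \neq 2,5$ be a prime with $p \equiv \pm 2 \pmod{5}$, let $a,n$ be positive integers with $n \not\equiv 0 \pmod{z(p)}$, and let $r = p^a n \bmod z(p)$, $s = n \bmod z(p)$, and $A = \left\lfloor \frac{n(p^a - 1)}{p^{\nu_p (n)}z(p)} \right\rfloor$. Then: (i) If $a$ is even, then $p \mid {p^a n \choose n}_F$ if and only if $s_p (A) > \frac{a}{2} (p - 1)$. (ii) If $a$ is odd and $p \nmid n$: if $r < s$, then $p \mid {p^a n \choose n}_F$; if $r \geq s$, then $p \mid {p^a n \choose n}_F$ if and only if $s_p (A) \geq \frac{a + 1}{2} (p - 1)$. (iii) If $a$ is odd and $p \mid n$: if $r\neq s$, then $p \mid {p^a n \choose n}_F$; if $r = s$, then $p \mid {p^a n \choose n}_F$ if and only if $s_p (A) \geq \frac{a + 1}{2} (p - 1)$.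
   Context: The Fibonacci sequence is $F_1=F_2=1$, $F_n=F_{n-1}+F_{n-2}$ for $n\ge 3$. For $m\ge 1$ and $1\le k\le m$ the Fibonomial coefficient is ${m \choose k}_F = \frac{F_1F_2\cdots F_m}{(F_1\cdots F_k)(F_1\cdots F_{m-k})}$ (an integer). $z(m)$, the rank of appearance of $m$, is the smallest positive integer $t$ with $m \mid F_t$. $\nu_p(x)$ is the exponent of $p$ in $x$; $s_p(n)$ is the sum of base-$p$ digits of $n$; $a \bmod m$ is the least nonnegative residue of $a$ modulo $m$. -}

module Defs where

open import Data.Nat
open import Data.Nat.Properties
open import Data.Nat.Divisibility using (_∣_)
open import Data.Nat.DivMod using (_/_; _%_)
open import Data.Product using (_×_)
open import Relation.Nullary using (¬_)

fib : ℕ → ℕ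
fib 0 = 0
fib 1 = 1
fib (suc (suc n)) = fib (suc n) + fib n

fibProd : ℕ → ℕ
fibProd 0 = 1
fibProd (suc m) = fibProd m * fib (suc m)

fib-suc-pos : ∀ n → 0 < fib (suc n)
fib-suc-pos 0 = s≤s z≤n
fib-suc-pos (suc n) = <-≤-trans (fib-suc-pos n) (m≤m+n (fib (suc n)) (fib n))

fibProd-pos : ∀ m → 0 < fibProd m
fibProd-pos 0 = s≤s z≤n
fibProd-pos (suc m) = *-mono-< (fibProd-pos m) (fib-suc-pos m)


denomPos : ∀ m k → 0 < fibProd k * fibProd (m ∸ k)
denomPos m k = *-mono-< (fibProd-pos k) (fibProd-pos (m ∸ k))

fibonomial : ℕ → ℕ → ℕ
fibonomial m k = _/_ (fibProd m) (fibProd k * fibProd (m ∸ k))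
  {{>-nonZero (denomPos m k)}}

IsRankOfAppearance : ℕ → ℕ → Set
IsRankOfAppearance m z =
  (0 < z) × (m ∣ fib z) × (∀ t → 0 < t → m ∣ fib t → z ≤ t)

IsValuation : ℕ → ℕ → ℕ → Set
IsValuation p n e = (p ^ e ∣ n) × ¬ (p ^ suc e ∣ n)

-- sum of base-p digits (fuel-based; fuel n suffices for p ≥ 2)
digitSumFuel : ℕ → (p : ℕ) → .{{NonZero p}} → ℕ → ℕ
digitSumFuel zero p n = 0
digitSumFuel (suc f) p n = n % p + digitSumFuel f p (n / p)

digitSum : (p : ℕ) → .{{NonZero p}} → ℕ → ℕ
digitSum p n = digitSumFuel n p n

-- floor division; divisor 0 never occurs in the statement (p, z(p) > 0)
floorDiv : ℕ → ℕ → ℕ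
floorDiv m zero = 0
floorDiv m (suc d) = m / suc d

sp : ℕ → ℕ → ℕ
sp zero n = 0
sp (suc q) n = digitSum (suc q) n

modN : ℕ → ℕ → ℕ
modN m zero = m
modN m (suc d) = m % suc d

module Submission where

-- 1. z ∣ p + 1 (module CyclotomicFive): in ℤ[x]/(x⁵ − 1) the powers of
--    α = −x − x⁴ carry the Fibonacci numbers, and Frobenius gives
--    αᵖ ≡ (−x)ᵖ + (−x⁴)ᵖ (mod p), whose Fibonacci part vanishes as p ≡ ±3 (mod 10).
-- 2. General facts on Euclidean division, the rank of appearance, p-adic
--    valuations and base-p digit sums s (Legendre's formula, subadditivity).
-- 3. Lifting the exponent, ν(F(Jz)) = e + ν(J), gives a Legendre formula
--    q·ν(F(1)⋯F(m)) + s(⌊m/z⌋) = K·⌊m/z⌋ with K = qe + 1, hence a Kummer-type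
--    theorem: adding N and W in base z, q·ν((N+W choose N)_F) = s(Y) + s(W′) − s(X)
--    for the quotients X, Y, W′ by z if there is no carry, and ν > 0 otherwise.
-- 4. As p ≡ −1 (mod z), the base-z digits of p^{2k}n and p^{2k+1}n are explicit;
--    comparing them with n gives each part of the theorem through one of two
--    elementary arithmetic criteria.

module CyclotomicFive where

  open import Level using (0ℓ)
  open import Data.Nat as ℕ using (ℕ; zero; suc; _∸_; _%_; _/_; _!)
  import Data.Nat.Properties as ℕ
  open import Data.Nat.DivMod using (m≡m%n+[m/n]*n; m%n<n; m∣n⇒o%n%m≡o%m; m*n/n≡m)
  open import Data.Nat.Divisibility as ℕ∣ using (divides)
  open import Data.Nat.Primality using (Prime; euclidsLemma; prime⇒nonTrivial; prime⇒nonZero; prime⇒irreducible)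
  open import Data.Nat.Combinatorics using (_C_; nCn≡1; nCk≡n!/k![n-k]!; k![n∸k]!∣n!)
  open import Data.Integer using (ℤ; +_; -_; _+_; _*_; _-_; ∣_∣)
  import Data.Integer.Properties as ℤ
  open import Data.Integer.Solver using (module +-*-Solver)
  open import Data.Fin using (Fin; toℕ; fromℕ) renaming (zero to fzero; suc to fsuc)
  open import Data.Fin.Properties using (toℕ-fromℕ)
  open import Data.Vec.Functional using (foldr)
  open import Data.Product using (Σ; _,_; _×_; proj₁; proj₂)
  open import Data.Sum using (_⊎_; inj₁; inj₂)
  open import Data.Empty using (⊥-elim)
  open import Relation.Nullary using (¬_)
  open import Relation.Binary.PropositionalEquality
  open import Function using (_$_)
  open import Algebra.Bundles using (Semiring)
  open import Defs using (fib)

  -- Elements of ℤ[x]/(x⁵ − 1): coefficient vectors of 1, x, x², x³, x⁴.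
  record Cyc (A : Set) : Set where
    constructor mk
    field c0 c1 c2 c3 c4 : A
  open Cyc

  -- Multiplication by x⁻¹, i.e. a cyclic shift of the coefficients.
  rot : ∀ {A} → Cyc A → Cyc A
  rot (mk a0 a1 a2 a3 a4) = mk a1 a2 a3 a4 a0

  -- The ring operations, written over an arbitrary carrier so that they can
  -- be instantiated both on ℤ and on the solver's polynomial syntax. The
  -- product is the cyclic convolution; coordinate k of x·y is the pairing
  -- 'dot' of the k-th shift of x with y.
  module Arith {A : Set} (_+'_ _*'_ : A → A → A) where
    add : Cyc A → Cyc A → Cyc A
    add (mk a0 a1 a2 a3 a4) (mk b0 b1 b2 b3 b4) = mk (a0 +' b0) (a1 +' b1) (a2 +' b2) (a3 +' b3) (a4 +' b4)

    dot : Cyc A → Cyc A → A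
    dot (mk a0 a1 a2 a3 a4) (mk b0 b1 b2 b3 b4) = (a0 *' b0) +' ((a1 *' b4) +' ((a2 *' b3) +' ((a3 *' b2) +' (a4 *' b1))))

    mul : Cyc A → Cyc A → Cyc A
    mul x y = mk (dot x y) (dot (rot x) y) (dot (rot (rot x)) y) (dot (rot (rot (rot x))) y) (dot (rot (rot (rot (rot x)))) y)

  open Arith _+_ _*_ using (dot)

  infixl 6 _⊕_
  infixl 7 _⊗_
  _⊕_ _⊗_ : Cyc ℤ → Cyc ℤ → Cyc ℤ
  _⊕_ = Arith.add _+_ _*_
  _⊗_ = Arith.mul _+_ _*_

  𝟘 𝟙 : Cyc ℤ
  𝟘 = mk (+ 0) (+ 0) (+ 0) (+ 0) (+ 0)
  𝟙 = mk (+ 1) (+ 0) (+ 0) (+ 0) (+ 0)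

  mk≡ : ∀ {a0 a1 a2 a3 a4 b0 b1 b2 b3 b4 : ℤ} → a0 ≡ b0 → a1 ≡ b1 → a2 ≡ b2 → a3 ≡ b3 → a4 ≡ b4 →
        mk a0 a1 a2 a3 a4 ≡ mk b0 b1 b2 b3 b4
  mk≡ refl refl refl refl refl = refl

  -- The identities of the pairing from which all ring laws follow, checked by
  -- the ring solver on symbolic coefficients.
  module _ where
    open +-*-Solver
    private
      module E = Arith {Polynomial 15} _:+_ _:*_
      module E₅ = Arith {Polynomial 5} _:+_ _:*_
      o i : Polynomial 5
      o = con (+ 0)
      i = con (+ 1)

    dot-assoc : ∀ x y z → dot (x ⊗ y) z ≡ dot x (y ⊗ z)
    dot-assoc (mk a0 a1 a2 a3 a4) (mk b0 b1 b2 b3 b4) (mk d0 d1 d2 d3 d4) =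
      solve 15 (λ a0 a1 a2 a3 a4 b0 b1 b2 b3 b4 d0 d1 d2 d3 d4 →
          E.dot (E.mul (mk a0 a1 a2 a3 a4) (mk b0 b1 b2 b3 b4)) (mk d0 d1 d2 d3 d4)
       := E.dot (mk a0 a1 a2 a3 a4) (E.mul (mk b0 b1 b2 b3 b4) (mk d0 d1 d2 d3 d4)))
        refl a0 a1 a2 a3 a4 b0 b1 b2 b3 b4 d0 d1 d2 d3 d4

    dot-distribˡ : ∀ x y z → dot (x ⊕ y) z ≡ dot x z + dot y z
    dot-distribˡ (mk a0 a1 a2 a3 a4) (mk b0 b1 b2 b3 b4) (mk d0 d1 d2 d3 d4) =
      solve 15 (λ a0 a1 a2 a3 a4 b0 b1 b2 b3 b4 d0 d1 d2 d3 d4 →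
          E.dot (E.add (mk a0 a1 a2 a3 a4) (mk b0 b1 b2 b3 b4)) (mk d0 d1 d2 d3 d4)
       := E.dot (mk a0 a1 a2 a3 a4) (mk d0 d1 d2 d3 d4) :+ E.dot (mk b0 b1 b2 b3 b4) (mk d0 d1 d2 d3 d4))
        refl a0 a1 a2 a3 a4 b0 b1 b2 b3 b4 d0 d1 d2 d3 d4

    dot-distribʳ : ∀ x y z → dot x (y ⊕ z) ≡ dot x y + dot x z
    dot-distribʳ (mk a0 a1 a2 a3 a4) (mk b0 b1 b2 b3 b4) (mk d0 d1 d2 d3 d4) =
      solve 15 (λ a0 a1 a2 a3 a4 b0 b1 b2 b3 b4 d0 d1 d2 d3 d4 →
          E.dot (mk a0 a1 a2 a3 a4) (E.add (mk b0 b1 b2 b3 b4) (mk d0 d1 d2 d3 d4))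
       := E.dot (mk a0 a1 a2 a3 a4) (mk b0 b1 b2 b3 b4) :+ E.dot (mk a0 a1 a2 a3 a4) (mk d0 d1 d2 d3 d4))
        refl a0 a1 a2 a3 a4 b0 b1 b2 b3 b4 d0 d1 d2 d3 d4

    dot-zeroˡ : ∀ x → dot 𝟘 x ≡ + 0
    dot-zeroˡ (mk a0 a1 a2 a3 a4) =
      solve 5 (λ a0 a1 a2 a3 a4 → E₅.dot (mk o o o o o) (mk a0 a1 a2 a3 a4) := o) refl a0 a1 a2 a3 a4

    dot-zeroʳ : ∀ x → dot x 𝟘 ≡ + 0
    dot-zeroʳ (mk a0 a1 a2 a3 a4) =
      solve 5 (λ a0 a1 a2 a3 a4 → E₅.dot (mk a0 a1 a2 a3 a4) (mk o o o o o) := o) refl a0 a1 a2 a3 a4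

    dot-oneʳ : ∀ x → dot x 𝟙 ≡ c0 x
    dot-oneʳ (mk a0 a1 a2 a3 a4) =
      solve 5 (λ a0 a1 a2 a3 a4 → E₅.dot (mk a0 a1 a2 a3 a4) (mk i o o o o) := a0) refl a0 a1 a2 a3 a4

    one-⊗ : ∀ x → 𝟙 ⊗ x ≡ x
    one-⊗ (mk a0 a1 a2 a3 a4) = mk≡
      (solve 5 (λ a0 a1 a2 a3 a4 → E₅.dot (mk i o o o o) (mk a0 a1 a2 a3 a4) := a0) refl a0 a1 a2 a3 a4)
      (solve 5 (λ a0 a1 a2 a3 a4 → E₅.dot (mk o o o o i) (mk a0 a1 a2 a3 a4) := a1) refl a0 a1 a2 a3 a4)
      (solve 5 (λ a0 a1 a2 a3 a4 → E₅.dot (mk o o o i o) (mk a0 a1 a2 a3 a4) := a2) refl a0 a1 a2 a3 a4)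
      (solve 5 (λ a0 a1 a2 a3 a4 → E₅.dot (mk o o i o o) (mk a0 a1 a2 a3 a4) := a3) refl a0 a1 a2 a3 a4)
      (solve 5 (λ a0 a1 a2 a3 a4 → E₅.dot (mk o i o o o) (mk a0 a1 a2 a3 a4) := a4) refl a0 a1 a2 a3 a4)

  -- Each ring law holds coordinatewise; coordinate k is the corresponding
  -- pairing law applied to k-th shifts (rot commutes definitionally with ⊕,
  -- and rot (x ⊗ y) is definitionally rot x ⊗ y).
  ⊕-assoc : ∀ x y z → (x ⊕ y) ⊕ z ≡ x ⊕ (y ⊕ z)
  ⊕-assoc x y z = mk≡ (ℤ.+-assoc (c0 x) _ _) (ℤ.+-assoc (c1 x) _ _) (ℤ.+-assoc (c2 x) _ _) (ℤ.+-assoc (c3 x) _ _) (ℤ.+-assoc (c4 x) _ _)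

  ⊕-comm : ∀ x y → x ⊕ y ≡ y ⊕ x
  ⊕-comm x y = mk≡ (ℤ.+-comm (c0 x) _) (ℤ.+-comm (c1 x) _) (ℤ.+-comm (c2 x) _) (ℤ.+-comm (c3 x) _) (ℤ.+-comm (c4 x) _)

  ⊕-identityˡ : ∀ x → 𝟘 ⊕ x ≡ x
  ⊕-identityˡ x = mk≡ (ℤ.+-identityˡ _) (ℤ.+-identityˡ _) (ℤ.+-identityˡ _) (ℤ.+-identityˡ _) (ℤ.+-identityˡ _)

  ⊕-identityʳ : ∀ x → x ⊕ 𝟘 ≡ x
  ⊕-identityʳ x = mk≡ (ℤ.+-identityʳ _) (ℤ.+-identityʳ _) (ℤ.+-identityʳ _) (ℤ.+-identityʳ _) (ℤ.+-identityʳ _)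

  ⊗-assoc : ∀ x y z → (x ⊗ y) ⊗ z ≡ x ⊗ (y ⊗ z)
  ⊗-assoc x y z = mk≡ (dot-assoc x y z) (dot-assoc (rot x) y z) (dot-assoc (rot (rot x)) y z)
                      (dot-assoc (rot (rot (rot x))) y z) (dot-assoc (rot (rot (rot (rot x)))) y z)

  ⊗-one : ∀ x → x ⊗ 𝟙 ≡ x
  ⊗-one x = mk≡ (dot-oneʳ x) (dot-oneʳ (rot x)) (dot-oneʳ (rot (rot x))) (dot-oneʳ (rot (rot (rot x)))) (dot-oneʳ (rot (rot (rot (rot x)))))

  ⊗-distribˡ : ∀ x y z → x ⊗ (y ⊕ z) ≡ x ⊗ y ⊕ x ⊗ z
  ⊗-distribˡ x y z = mk≡ (dot-distribʳ x y z) (dot-distribʳ (rot x) y z) (dot-distribʳ (rot (rot x)) y z)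
                         (dot-distribʳ (rot (rot (rot x))) y z) (dot-distribʳ (rot (rot (rot (rot x)))) y z)

  ⊗-distribʳ : ∀ x y z → (y ⊕ z) ⊗ x ≡ y ⊗ x ⊕ z ⊗ x
  ⊗-distribʳ x y z = mk≡ (dot-distribˡ y z x) (dot-distribˡ (rot y) (rot z) x) (dot-distribˡ (rot (rot y)) (rot (rot z)) x)
                         (dot-distribˡ (rot (rot (rot y))) (rot (rot (rot z))) x)
                         (dot-distribˡ (rot (rot (rot (rot y)))) (rot (rot (rot (rot z)))) x)

  zero-⊗ : ∀ x → 𝟘 ⊗ x ≡ 𝟘
  zero-⊗ x = mk≡ (dot-zeroˡ x) (dot-zeroˡ x) (dot-zeroˡ x) (dot-zeroˡ x) (dot-zeroˡ x)

  ⊗-zero : ∀ x → x ⊗ 𝟘 ≡ 𝟘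
  ⊗-zero x = mk≡ (dot-zeroʳ x) (dot-zeroʳ (rot x)) (dot-zeroʳ (rot (rot x))) (dot-zeroʳ (rot (rot (rot x)))) (dot-zeroʳ (rot (rot (rot (rot x)))))

  cyc-semiring : Semiring 0ℓ 0ℓ
  cyc-semiring = record
    { Carrier = Cyc ℤ ; _≈_ = _≡_ ; _+_ = _⊕_ ; _*_ = _⊗_ ; 0# = 𝟘 ; 1# = 𝟙
    ; isSemiring = record
      { isSemiringWithoutAnnihilatingZero = record
        { +-isCommutativeMonoid = record
          { isMonoid = record
            { isSemigroup = record { isMagma = record { isEquivalence = isEquivalence ; ∙-cong = cong₂ _⊕_ } ; assoc = ⊕-assoc }
            ; identity = ⊕-identityˡ , ⊕-identityʳ }
          ; comm = ⊕-comm }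
        ; *-cong = cong₂ _⊗_ ; *-assoc = ⊗-assoc ; *-identity = one-⊗ , ⊗-one ; distrib = ⊗-distribˡ , ⊗-distribʳ }
      ; zero = zero-⊗ , ⊗-zero } }

  open import Algebra.Properties.Semiring.Exp cyc-semiring using (_^_; ^-homo-*; ^-assocʳ)
  open import Algebra.Properties.Semiring.Mult cyc-semiring using () renaming (_×_ to _·_)

  scale : ℕ → Cyc ℤ → Cyc ℤ
  scale n (mk a0 a1 a2 a3 a4) = mk (+ n * a0) (+ n * a1) (+ n * a2) (+ n * a3) (+ n * a4)

  record _∣ᶜ_ (p : ℕ) (v : Cyc ℤ) : Set where
    constructor multiple
    field
      quotient : Cyc ℤ
      equality : v ≡ scale p quotient

  ·≡scale : ∀ n v → n · v ≡ scale n v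
  ·≡scale zero v = mk≡ (sym (ℤ.*-zeroˡ (c0 v))) (sym (ℤ.*-zeroˡ (c1 v))) (sym (ℤ.*-zeroˡ (c2 v))) (sym (ℤ.*-zeroˡ (c3 v))) (sym (ℤ.*-zeroˡ (c4 v)))
  ·≡scale (suc n) v = trans (cong (v ⊕_) (·≡scale n v)) (mk≡ (step (c0 v)) (step (c1 v)) (step (c2 v)) (step (c3 v)) (step (c4 v)))
    where
    step : ∀ a → a + + n * a ≡ + suc n * a
    step a = sym (trans (ℤ.*-distribʳ-+ a (+ 1) (+ n)) (cong (_+ + n * a) (ℤ.*-identityˡ a)))

  ∣ᶜ-⊕ : ∀ {p u v} → p ∣ᶜ u → p ∣ᶜ v → p ∣ᶜ (u ⊕ v)
  ∣ᶜ-⊕ {p} (multiple w₁ refl) (multiple w₂ refl) = multiple (w₁ ⊕ w₂) $ mk≡ (dist (c0 w₁) _) (dist (c1 w₁) _) (dist (c2 w₁) _) (dist (c3 w₁) _) (dist (c4 w₁) _)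
    where
    dist : ∀ a b → + p * a + + p * b ≡ + p * (a + b)
    dist a b = sym (ℤ.*-distribˡ-+ (+ p) a b)

  ∣ᶜ-𝟘 : ∀ {p} → p ∣ᶜ 𝟘
  ∣ᶜ-𝟘 {p} = multiple 𝟘 (mk≡ z z z z z)
    where z = sym (ℤ.*-zeroʳ (+ p))

  ∣ᶜ-· : ∀ {p} n v → p ℕ∣.∣ n → p ∣ᶜ (n · v)
  ∣ᶜ-· {p} .(c ℕ.* p) v (divides c refl) = multiple (scale c v) (trans (·≡scale (c ℕ.* p) v) (mk≡ (reassoc (c0 v)) (reassoc (c1 v)) (reassoc (c2 v)) (reassoc (c3 v)) (reassoc (c4 v))))
    where
    reassoc : ∀ a → + (c ℕ.* p) * a ≡ + p * (+ c * a)
    reassoc a = begin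
      + (c ℕ.* p) * a ≡⟨ cong (_* a) (ℤ.pos-* c p) ⟩
      (+ c * + p) * a ≡⟨ cong (_* a) (ℤ.*-comm (+ c) (+ p)) ⟩
      (+ p * + c) * a ≡⟨ ℤ.*-assoc (+ p) (+ c) a ⟩
      + p * (+ c * a) ∎
      where open ≡-Reasoning

  prime∤! : ∀ {p} → Prime p → ∀ m → m ℕ.< p → ¬ p ℕ∣.∣ m !
  prime∤! pp zero _ p∣1 = ℕ.nonTrivial⇒≢1 {{prime⇒nonTrivial pp}} (ℕ∣.∣1⇒≡1 p∣1)
  prime∤! pp (suc m) m<p p∣m! with euclidsLemma (suc m) (m !) pp p∣m!
  ... | inj₁ p∣1+m = ℕ.<⇒≱ m<p (ℕ∣.∣⇒≤ p∣1+m)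
  ... | inj₂ p∣m!  = prime∤! pp m (ℕ.<⇒≤ m<p) p∣m!

  prime∣choose : ∀ {p} → Prime p → ∀ k → 0 ℕ.< k → k ℕ.< p → p ℕ∣.∣ (p C k)
  prime∣choose {p} pp k 0<k k<p with euclidsLemma (p C k) (k ! ℕ.* (p ∸ k) !) pp p∣C·k![p-k]!
    where
    instance _ = ℕ._!*_!≢0 k (p ∸ k)
    p!≡C·k![p-k]! : p ! ≡ (p C k) ℕ.* (k ! ℕ.* (p ∸ k) !)
    p!≡C·k![p-k]! with k![n∸k]!∣n! {p} {k} (ℕ.<⇒≤ k<p)
    ... | divides c p!≡c·d = trans p!≡c·d (cong (ℕ._* (k ! ℕ.* (p ∸ k) !)) (sym (begin
      p C k                          ≡⟨ nCk≡n!/k![n-k]! (ℕ.<⇒≤ k<p) ⟩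
      p ! / (k ! ℕ.* (p ∸ k) !)      ≡⟨ cong (_/ (k ! ℕ.* (p ∸ k) !)) p!≡c·d ⟩
      c ℕ.* (k ! ℕ.* (p ∸ k) !) / (k ! ℕ.* (p ∸ k) !) ≡⟨ m*n/n≡m c _ ⟩
      c ∎)))
      where open ≡-Reasoning
    p∣C·k![p-k]! : p ℕ∣.∣ (p C k) ℕ.* (k ! ℕ.* (p ∸ k) !)
    p∣C·k![p-k]! = subst (p ℕ∣.∣_) p!≡C·k![p-k]! (p∣p! p (prime⇒nonZero pp))
      where
      p∣p! : ∀ n → ℕ.NonZero n → n ℕ∣.∣ n !
      p∣p! (suc n) _ = ℕ∣.m∣m*n (n !)
  ... | inj₁ p∣C = p∣C
  ... | inj₂ p∣k![p-k]! with euclidsLemma (k !) ((p ∸ k) !) pp p∣k![p-k]!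
  ...   | inj₁ p∣k! = ⊥-elim (prime∤! pp k k<p p∣k!)
  ...   | inj₂ p∣[p-k]! = ⊥-elim (prime∤! pp (p ∸ k) (ℕ.∸-monoʳ-< 0<k (ℕ.<⇒≤ k<p)) p∣[p-k]!)

  sum≡last : ∀ {p} n (g : Fin (suc n) → Cyc ℤ) → (∀ i → toℕ i ℕ.< n → p ∣ᶜ g i) →
             Σ (Cyc ℤ) λ M → p ∣ᶜ M × foldr _⊕_ 𝟘 g ≡ g (fromℕ n) ⊕ M
  sum≡last zero g _ = 𝟘 , ∣ᶜ-𝟘 , refl
  sum≡last (suc n) g inner with sum≡last n (λ i → g (fsuc i)) (λ i i<n → inner (fsuc i) (ℕ.s≤s i<n))
  ... | M , p∣M , sum≡ = g fzero ⊕ M , ∣ᶜ-⊕ (inner fzero (ℕ.s≤s ℕ.z≤n)) p∣M , (begin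
      g fzero ⊕ foldr _⊕_ 𝟘 (λ i → g (fsuc i)) ≡⟨ cong (g fzero ⊕_) sum≡ ⟩
      g fzero ⊕ (g (fromℕ (suc n)) ⊕ M)        ≡⟨ sym (⊕-assoc (g fzero) (g (fromℕ (suc n))) M) ⟩
      (g fzero ⊕ g (fromℕ (suc n))) ⊕ M        ≡⟨ cong (_⊕ M) (⊕-comm (g fzero) (g (fromℕ (suc n)))) ⟩
      (g (fromℕ (suc n)) ⊕ g fzero) ⊕ M        ≡⟨ ⊕-assoc (g (fromℕ (suc n))) (g fzero) M ⟩
      g (fromℕ (suc n)) ⊕ (g fzero ⊕ M)        ∎)
    where open ≡-Reasoning

  module _ (x y : Cyc ℤ) where
    open import Algebra.Properties.Semiring.Binomial cyc-semiring x y using (binomialTerm; theorem)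

    private
      first-term : ∀ n → binomialTerm n fzero ≡ y ^ n
      first-term n = trans (⊕-identityʳ _) (one-⊗ _)

      last-term : ∀ n → binomialTerm n (fromℕ n) ≡ x ^ n
      last-term n = begin
        binomialTerm n (fromℕ n)      ≡⟨ cong (λ t → (n C t) · (x ^ t ⊗ y ^ (n ∸ t))) (toℕ-fromℕ n) ⟩
        (n C n) · (x ^ n ⊗ y ^ (n ∸ n)) ≡⟨ cong₂ (λ c e → c · (x ^ n ⊗ y ^ e)) (nCn≡1 n) (ℕ.n∸n≡0 n) ⟩
        1 · (x ^ n ⊗ 𝟙)                ≡⟨ trans (⊕-identityʳ _) (⊗-one _) ⟩
        x ^ n                          ∎
        where open ≡-Reasoning

    -- Frobenius: for commuting x, y and a prime p, (x + y)ᵖ ≡ yᵖ + xᵖ (mod p),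
    -- since p divides all the inner binomial coefficients.
    frobenius : ∀ {p} → Prime p → x ⊗ y ≡ y ⊗ x →
                Σ (Cyc ℤ) λ M → p ∣ᶜ M × (x ⊕ y) ^ p ≡ y ^ p ⊕ (x ^ p ⊕ M)
    frobenius {suc n} pp xy≡yx = conclude (sum≡last n (λ i → binomialTerm (suc n) (fsuc i)) inner)
      where
      inner : ∀ i → toℕ i ℕ.< n → suc n ∣ᶜ binomialTerm (suc n) (fsuc i)
      inner i i<n = ∣ᶜ-· (suc n C suc (toℕ i)) (x ^ suc (toℕ i) ⊗ y ^ (n ∸ toℕ i))
                         (prime∣choose pp (suc (toℕ i)) (ℕ.s≤s ℕ.z≤n) (ℕ.s≤s i<n))
      conclude : Σ (Cyc ℤ) (λ M → suc n ∣ᶜ M × foldr _⊕_ 𝟘 (λ i → binomialTerm (suc n) (fsuc i)) ≡ binomialTerm (suc n) (fsuc (fromℕ n)) ⊕ M) →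
                 Σ (Cyc ℤ) λ M → suc n ∣ᶜ M × (x ⊕ y) ^ suc n ≡ y ^ suc n ⊕ (x ^ suc n ⊕ M)
      conclude (M , p∣M , sum≡) = M , p∣M , trans (theorem xy≡yx (suc n))
        (cong₂ _⊕_ (first-term (suc n)) (trans sum≡ (cong (_⊕ M) (last-term (suc n)))))

  -- α = −x − x⁴ is a root of t² = t + 1 modulo 1 + x + ⋯ + x⁴ (it is the image
  -- of (1 − √5)/2 under x ↦ e^{2πi/5}), so its powers carry the Fibonacci numbers.
  −x −x⁴ α : Cyc ℤ
  −x = mk (+ 0) (- + 1) (+ 0) (+ 0) (+ 0)
  −x⁴ = mk (+ 0) (+ 0) (+ 0) (+ 0) (- + 1)
  α = −x ⊕ −x⁴

  -- Fₙ + Fₙ₊₁·α + c·(1 + x + x² + x³ + x⁴)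
  fibForm : ℕ → ℤ → Cyc ℤ
  fibForm n c = mk (+ fib n + c) (- + fib (suc n) + c) c c (- + fib (suc n) + c)

  α-power : ∀ n → Σ ℤ λ c → α ^ suc n ≡ fibForm n c
  α-power zero = + 0 , refl
  α-power (suc n) with α-power n
  ... | c , αⁿ⁺¹≡ = + fib (suc n) - c - c , trans (cong (α ⊗_) αⁿ⁺¹≡) (step (+ fib n) (+ fib (suc n)) c)
    where
    open +-*-Solver
    module E = Arith {Polynomial 3} _:+_ _:*_
    o ı : Polynomial 3
    o = con (+ 0)
    ı = con (- + 1)
    Eα : Polynomial 3 → Polynomial 3 → Polynomial 3 → Cyc (Polynomial 3)
    Eα F₀ F₁ c = mk (F₀ :+ c) (:- F₁ :+ c) c c (:- F₁ :+ c)
    step : ∀ F₀ F₁ c → α ⊗ mk (F₀ + c) (- F₁ + c) c c (- F₁ + c)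
                     ≡ mk (F₁ + (F₁ - c - c)) (- (F₁ + F₀) + (F₁ - c - c)) (F₁ - c - c) (F₁ - c - c) (- (F₁ + F₀) + (F₁ - c - c))
    step F₀ F₁ c = mk≡
      (solve 3 (λ F₀ F₁ c → E.dot (mk o ı o o ı) (Eα F₀ F₁ c) := F₁ :+ (F₁ :- c :- c)) refl F₀ F₁ c)
      (solve 3 (λ F₀ F₁ c → E.dot (mk ı o o ı o) (Eα F₀ F₁ c) := :- (F₁ :+ F₀) :+ (F₁ :- c :- c)) refl F₀ F₁ c)
      (solve 3 (λ F₀ F₁ c → E.dot (mk o o ı o ı) (Eα F₀ F₁ c) := F₁ :- c :- c) refl F₀ F₁ c)
      (solve 3 (λ F₀ F₁ c → E.dot (mk o ı o ı o) (Eα F₀ F₁ c) := F₁ :- c :- c) refl F₀ F₁ c)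
      (solve 3 (λ F₀ F₁ c → E.dot (mk ı o ı o o) (Eα F₀ F₁ c) := :- (F₁ :+ F₀) :+ (F₁ :- c :- c)) refl F₀ F₁ c)

  -- The linear functional v ↦ v₀ − v₁; it vanishes on 1 + x + ⋯ + x⁴ and
  -- reads off Fₙ₊₂ from αⁿ⁺¹.
  τ : Cyc ℤ → ℤ
  τ v = c0 v - c1 v

  τ-⊕ : ∀ u v → τ (u ⊕ v) ≡ τ u + τ v
  τ-⊕ u v = solve 4 (λ a₀ a₁ b₀ b₁ → (a₀ :+ b₀) :- (a₁ :+ b₁) := (a₀ :- a₁) :+ (b₀ :- b₁)) refl (c0 u) (c1 u) (c0 v) (c1 v)
    where open +-*-Solver

  τ-scale : ∀ p w → τ (scale p w) ≡ + p * τ w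
  τ-scale p w = solve 3 (λ P a₀ a₁ → P :* a₀ :- P :* a₁ := P :* (a₀ :- a₁)) refl (+ p) (c0 w) (c1 w)
    where open +-*-Solver

  τ-fibForm : ∀ n c → τ (fibForm n c) ≡ + fib (suc (suc n))
  τ-fibForm n c = solve 3 (λ F₀ F₁ c → (F₀ :+ c) :- (:- F₁ :+ c) := F₁ :+ F₀) refl (+ fib n) (+ fib (suc n)) c
    where open +-*-Solver

  power-mod-10 : ∀ v → v ^ 10 ≡ 𝟙 → ∀ m → v ^ m ≡ v ^ (m % 10)
  power-mod-10 v v¹⁰≡𝟙 m = begin
    v ^ m                         ≡⟨ cong (v ^_) (m≡m%n+[m/n]*n m 10) ⟩
    v ^ (m % 10 ℕ.+ m / 10 ℕ.* 10) ≡⟨ ^-homo-* v (m % 10) (m / 10 ℕ.* 10) ⟩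
    v ^ (m % 10) ⊗ v ^ (m / 10 ℕ.* 10) ≡⟨ cong (v ^ (m % 10) ⊗_) (trans (cong (v ^_) (ℕ.*-comm (m / 10) 10)) (sym (^-assocʳ v 10 (m / 10)))) ⟩
    v ^ (m % 10) ⊗ (v ^ 10) ^ (m / 10) ≡⟨ cong (λ u → v ^ (m % 10) ⊗ u ^ (m / 10)) v¹⁰≡𝟙 ⟩
    v ^ (m % 10) ⊗ 𝟙 ^ (m / 10)     ≡⟨ cong (v ^ (m % 10) ⊗_) (𝟙^ (m / 10)) ⟩
    v ^ (m % 10) ⊗ 𝟙                ≡⟨ ⊗-one (v ^ (m % 10)) ⟩
    v ^ (m % 10)                   ∎
    where
    open ≡-Reasoning
    𝟙^ : ∀ k → 𝟙 ^ k ≡ 𝟙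
    𝟙^ zero = refl
    𝟙^ (suc k) = trans (cong (𝟙 ⊗_) (𝟙^ k)) (one-⊗ 𝟙)

  -- For an odd residue r mod 10 that is ±2 mod 5 (i.e. r ∈ {3, 7}), the
  -- powers (−x)ʳ and (−x⁴)ʳ are −x³ and −x², both killed by τ.
  τ-vanishes : ∀ r → r ℕ.< 10 → (r % 5 ≡ 2 ⊎ r % 5 ≡ 3) → r % 2 ≡ 1 → τ (−x ^ r) ≡ + 0 × τ (−x⁴ ^ r) ≡ + 0
  τ-vanishes 3 _ _ _ = refl , refl
  τ-vanishes 7 _ _ _ = refl , refl
  τ-vanishes 0 _ (inj₁ ()) _
  τ-vanishes 0 _ (inj₂ ()) _
  τ-vanishes 1 _ (inj₁ ()) _
  τ-vanishes 1 _ (inj₂ ()) _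
  τ-vanishes 2 _ _ ()
  τ-vanishes 4 _ _ ()
  τ-vanishes 5 _ (inj₁ ()) _
  τ-vanishes 5 _ (inj₂ ()) _
  τ-vanishes 6 _ _ ()
  τ-vanishes 8 _ _ ()
  τ-vanishes 9 _ (inj₁ ()) _
  τ-vanishes 9 _ (inj₂ ()) _
  τ-vanishes (suc (suc (suc (suc (suc (suc (suc (suc (suc (suc _)))))))))) (ℕ.s≤s (ℕ.s≤s (ℕ.s≤s (ℕ.s≤s (ℕ.s≤s (ℕ.s≤s (ℕ.s≤s (ℕ.s≤s (ℕ.s≤s (ℕ.s≤s ())))))))))) _ _

  odd-prime : ∀ {p} → Prime p → p ≢ 2 → p % 2 ≡ 1
  odd-prime {p} pp p≢2 with p % 2 | m%n<n p 2 | m≡m%n+[m/n]*n p 2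
  ... | 1 | _ | _ = refl
  ... | suc (suc _) | ℕ.s≤s (ℕ.s≤s ()) | _
  ... | 0 | _ | p≡[p/2]*2 with prime⇒irreducible pp (divides (p / 2) p≡[p/2]*2)
  ...   | inj₁ ()
  ...   | inj₂ 2≡p = ⊥-elim (p≢2 (sym 2≡p))

  -- A prime p ≡ ±2 (mod 5) divides F_{p+1}: τ(αᵖ) = F_{p+1}, while by
  -- Frobenius αᵖ ≡ (−x)ᵖ + (−x⁴)ᵖ (mod p) and τ kills both of these.
  prime∣fib[1+p] : ∀ {p} → Prime p → p ≢ 2 → (p % 5 ≡ 2 ⊎ p % 5 ≡ 3) → p ℕ∣.∣ fib (suc p)
  prime∣fib[1+p] {suc n} pp p≢2 p≡±2 = divides ∣ τ w ∣ (begin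
    fib (suc p)              ≡⟨ cong ∣_∣ F≡p·τw ⟩
    ∣ + p * τ w ∣            ≡⟨ ℤ.abs-* (+ p) (τ w) ⟩
    p ℕ.* ∣ τ w ∣            ≡⟨ ℕ.*-comm p _ ⟩
    ∣ τ w ∣ ℕ.* p            ∎)
    where
    open ≡-Reasoning
    p = suc n
    c = proj₁ (α-power n)
    F = frobenius −x −x⁴ pp refl
    M = proj₁ F
    w = _∣ᶜ_.quotient (proj₁ (proj₂ F))
    αᵖ≡fibForm : α ^ p ≡ fibForm n c
    αᵖ≡fibForm = proj₂ (α-power n)
    αᵖ≡Frobenius : α ^ p ≡ −x⁴ ^ p ⊕ (−x ^ p ⊕ M)
    αᵖ≡Frobenius = proj₂ (proj₂ F)
    M≡pw : M ≡ scale p w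
    M≡pw = _∣ᶜ_.equality (proj₁ (proj₂ F))
    r%5 : p % 10 % 5 ≡ 2 ⊎ p % 10 % 5 ≡ 3
    r%5 rewrite m∣n⇒o%n%m≡o%m 5 10 p (divides 2 refl) = p≡±2
    r%2 : p % 10 % 2 ≡ 1
    r%2 = trans (m∣n⇒o%n%m≡o%m 2 10 p (divides 5 refl)) (odd-prime pp p≢2)
    vanish = τ-vanishes (p % 10) (m%n<n p 10) r%5 r%2
    τ[−x]ᵖ≡0 : τ (−x ^ p) ≡ + 0
    τ[−x]ᵖ≡0 = trans (cong τ (power-mod-10 −x refl p)) (proj₁ vanish)
    τ[−x⁴]ᵖ≡0 : τ (−x⁴ ^ p) ≡ + 0
    τ[−x⁴]ᵖ≡0 = trans (cong τ (power-mod-10 −x⁴ refl p)) (proj₂ vanish)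
    F≡p·τw : + fib (suc p) ≡ + p * τ w
    F≡p·τw = begin
      + fib (suc p)                     ≡⟨ sym (τ-fibForm n c) ⟩
      τ (fibForm n c)                   ≡⟨ cong τ (trans (sym αᵖ≡fibForm) αᵖ≡Frobenius) ⟩
      τ (−x⁴ ^ p ⊕ (−x ^ p ⊕ M))         ≡⟨ τ-⊕ (−x⁴ ^ p) (−x ^ p ⊕ M) ⟩
      τ (−x⁴ ^ p) + τ (−x ^ p ⊕ M)       ≡⟨ cong (_+_ (τ (−x⁴ ^ p))) (τ-⊕ (−x ^ p) M) ⟩
      τ (−x⁴ ^ p) + (τ (−x ^ p) + τ M)   ≡⟨ cong₂ (λ a b → a + (b + τ M)) τ[−x⁴]ᵖ≡0 τ[−x]ᵖ≡0 ⟩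
      + 0 + (+ 0 + τ M)                 ≡⟨ trans (ℤ.+-identityˡ _) (ℤ.+-identityˡ (τ M)) ⟩
      τ M                               ≡⟨ cong τ M≡pw ⟩
      τ (scale p w)                     ≡⟨ τ-scale p w ⟩
      + p * τ w                         ∎

open import Defs
open import Data.Nat
open import Data.Nat.Properties
open import Data.Nat.Divisibility
open import Data.Nat.DivMod
open import Data.Nat.Primality
open import Data.Nat.Induction using (<-rec)
open import Data.Nat.Combinatorics using (k![n∸k]!∣n!)
open import Data.Nat.Tactic.RingSolver using (solve-∀)
open import Data.Product using (Σ; Σ-syntax; _×_; _,_; proj₁; proj₂)
open import Data.Sum using (_⊎_; inj₁; inj₂; [_,_]′)
open import Data.Empty using (⊥-elim)
open import Relation.Nullary using (¬_; yes; no)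
open import Relation.Binary.PropositionalEquality
open import Relation.Binary.Definitions using (tri<; tri≈; tri>)
open import Function.Bundles using (_⇔_; mk⇔; Equivalence)
open import Function.Construct.Composition using (_⇔-∘_)
open CyclotomicFive using (prime∣fib[1+p])

divmod-unique : ∀ {d} .{{_ : NonZero d}} x r → r < d → (r + x * d) % d ≡ r × (r + x * d) / d ≡ x
divmod-unique {d} x r r<d = rem , quot
  where
  rem : (r + x * d) % d ≡ r
  rem = trans ([m+kn]%n≡m%n r x d) (m<n⇒m%n≡m r<d)
  quot : (r + x * d) / d ≡ x
  quot = *-cancelʳ-≡ _ _ d (+-cancelˡ-≡ r _ _ (begin
    r + (r + x * d) / d * d                     ≡⟨ cong (_+ (r + x * d) / d * d) (sym rem) ⟩
    (r + x * d) % d + (r + x * d) / d * d       ≡⟨ sym (m≡m%n+[m/n]*n (r + x * d) d) ⟩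
    r + x * d                                   ∎))
    where open ≡-Reasoning

floorDiv≡/ : ∀ m d .{{_ : NonZero d}} → floorDiv m d ≡ m / d
floorDiv≡/ m (suc d) = refl

divmod-injective : ∀ {d} .{{_ : NonZero d}} r X r′ X′ → r < d → r′ < d → r + X * d ≡ r′ + X′ * d → r ≡ r′ × X ≡ X′
divmod-injective {d} r X r′ X′ r<d r′<d eq =
  trans (sym (proj₁ (divmod-unique X r r<d))) (trans (cong (_% d) eq) (proj₁ (divmod-unique X′ r′ r′<d))) ,
  trans (sym (proj₂ (divmod-unique X r r<d))) (trans (cong (_/ d) eq) (proj₂ (divmod-unique X′ r′ r′<d)))

sum-by-digits : ∀ d .{{_ : NonZero d}} Y W → Y + W ≡ (Y % d + W % d) + (Y / d + W / d) * d
sum-by-digits d Y W = trans (cong₂ _+_ (m≡m%n+[m/n]*n Y d) (m≡m%n+[m/n]*n W d)) (shuffle (Y % d) (W % d) (Y / d) (W / d) d)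
  where shuffle : ∀ a b x y d → a + x * d + (b + y * d) ≡ (a + b) + (x + y) * d
        shuffle = solve-∀

add-digits : ∀ d .{{_ : NonZero d}} Y W →
  (Y % d + W % d < d × (Y + W) % d ≡ Y % d + W % d × (Y + W) / d ≡ Y / d + W / d) ⊎
  (Y % d + W % d ≡ (Y + W) % d + d × (Y + W) / d ≡ suc (Y / d + W / d))
add-digits d Y W with Y % d + W % d <? d
... | yes no-carry = inj₁ (no-carry , proj₁ split , proj₂ split)
  where
  split = divmod-injective _ _ _ _ (m%n<n (Y + W) d) no-carry
            (trans (sym (m≡m%n+[m/n]*n (Y + W) d)) (sum-by-digits d Y W))
... | no carry = inj₂ (trans (sym c+d≡) (cong (_+ d) (sym (proj₁ split))) , proj₂ split)
  where
  c = Y % d + W % d ∸ d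
  c+d≡ : c + d ≡ Y % d + W % d
  c+d≡ = m∸n+n≡m (≮⇒≥ carry)
  c<d : c < d
  c<d = +-cancelʳ-< _ _ d (subst (_< d + d) (sym c+d≡) (+-mono-< (m%n<n Y d) (m%n<n W d)))
  split = divmod-injective _ _ _ _ (m%n<n (Y + W) d) c<d (begin
    (Y + W) % d + (Y + W) / d * d             ≡⟨ sym (m≡m%n+[m/n]*n (Y + W) d) ⟩
    Y + W                                     ≡⟨ sum-by-digits d Y W ⟩
    (Y % d + W % d) + (Y / d + W / d) * d     ≡⟨ cong (_+ (Y / d + W / d) * d) (sym c+d≡) ⟩
    c + d + (Y / d + W / d) * d               ≡⟨ carry-in c (Y / d + W / d) d ⟩
    c + suc (Y / d + W / d) * d               ∎)
    where open ≡-Reasoning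
          carry-in : ∀ c x d → c + d + x * d ≡ c + suc x * d
          carry-in = solve-∀

fib-add : ∀ a b → fib (suc (a + b)) ≡ fib (suc a) * fib (suc b) + fib a * fib b
fib-add zero b = sym (trans (+-identityʳ _) (*-identityˡ _))
fib-add (suc zero) b = cong₂ _+_ (sym (*-identityˡ (fib (suc b)))) (sym (*-identityˡ (fib b)))
fib-add (suc (suc a)) b =
  trans (cong₂ _+_ (fib-add (suc a) b) (fib-add a b)) (regroup (fib (suc a)) (fib a) (fib (suc b)) (fib b))
  where
  regroup : ∀ y w u v → (y + w) * u + y * v + (y * u + w * v) ≡ ((y + w) + y) * u + (y + w) * v
  regroup = solve-∀

fib-consecutive-coprime : ∀ {d} k → d ∣ fib k → d ∣ fib (suc k) → d ∣ 1
fib-consecutive-coprime zero _ d∣F₁ = d∣F₁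
fib-consecutive-coprime (suc k) d∣Fₖ₊₁ d∣Fₖ₊₂ = fib-consecutive-coprime k (∣m+n∣m⇒∣n d∣Fₖ₊₂ d∣Fₖ₊₁) d∣Fₖ₊₁

fib∣fib-multiple : ∀ k j → fib k ∣ fib (j * k)
fib∣fib-multiple k zero = fib k ∣0
fib∣fib-multiple zero j rewrite *-zeroʳ j = ∣-refl
fib∣fib-multiple (suc k) (suc j) =
  subst (fib (suc k) ∣_) (sym (fib-add k (j * suc k)))
    (∣m∣n⇒∣m+n (m∣m*n _) (∣-trans (fib∣fib-multiple (suc k) j) (n∣m*n (fib k))))

prime∤1 : ∀ {p} → Prime p → ¬ p ∣ 1
prime∤1 pp p∣1 = nonTrivial⇒≢1 {{prime⇒nonTrivial pp}} (∣1⇒≡1 p∣1)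

module Rank {p z : ℕ} (pp : Prime p) (R : IsRankOfAppearance p z) where
  instance
    z≢0 : NonZero z
    z≢0 = >-nonZero (proj₁ R)

  p∣Fz : p ∣ fib z
  p∣Fz = proj₁ (proj₂ R)

  p∣F[jz] : ∀ j → p ∣ fib (j * z)
  p∣F[jz] j = ∣-trans p∣Fz (fib∣fib-multiple z j)

  -- ... and nowhere strictly between: F(jz + ρ) = F(jz+1)F(ρ) + F(jz)F(ρ−1), and
  -- p divides neither F(jz+1) (coprime to F(jz)) nor F(ρ) (minimality of z), 0 < ρ < z.
  p∤F[jz+ρ] : ∀ j ρ → 0 < ρ → ρ < z → ¬ p ∣ fib (j * z + ρ)
  p∤F[jz+ρ] j (suc ρ) _ ρ<z p∣F with euclidsLemma (fib (suc (j * z))) (fib (suc ρ)) pp p∣product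
    where
    p∣product : p ∣ fib (suc (j * z)) * fib (suc ρ)
    p∣product = ∣m+n∣m⇒∣n (subst (p ∣_) (+-comm _ (fib (j * z) * fib ρ)) p∣sum) (∣-trans (p∣F[jz] j) (m∣m*n (fib ρ)))
      where
      p∣sum : p ∣ fib (suc (j * z)) * fib (suc ρ) + fib (j * z) * fib ρ
      p∣sum = subst (p ∣_) (trans (cong fib (+-suc (j * z) ρ)) (fib-add (j * z) ρ)) p∣F
  ... | inj₁ p∣F[jz+1] = prime∤1 pp (fib-consecutive-coprime (j * z) (p∣F[jz] j) p∣F[jz+1])
  ... | inj₂ p∣F[1+ρ] = <⇒≱ ρ<z (proj₂ (proj₂ R) (suc ρ) (s≤s z≤n) p∣F[1+ρ])

  rank∣ : ∀ k → p ∣ fib k → z ∣ k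
  rank∣ k p∣Fₖ with k % z | m%n<n k z | m≡m%n+[m/n]*n k z
  ... | zero  | _   | k≡ = divides (k / z) k≡
  ... | suc ρ | ρ<z | k≡ = ⊥-elim (p∤F[jz+ρ] (k / z) (suc ρ) (s≤s z≤n) ρ<z
                                     (subst (λ t → p ∣ fib t) (trans k≡ (+-comm (suc ρ) _)) p∣Fₖ))

p^m∣p^n : ∀ p {m n} → m ≤ n → p ^ m ∣ p ^ n
p^m∣p^n p {m} {n} m≤n = divides (p ^ (n ∸ m)) (begin
  p ^ n                 ≡⟨ cong (p ^_) (sym (m+[n∸m]≡n m≤n)) ⟩
  p ^ (m + (n ∸ m))     ≡⟨ ^-distribˡ-+-* p m (n ∸ m) ⟩
  p ^ m * p ^ (n ∸ m)   ≡⟨ *-comm (p ^ m) _ ⟩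
  p ^ (n ∸ m) * p ^ m   ∎)
  where open ≡-Reasoning

module Valuation {p : ℕ} (pp : Prime p) where
  instance
    p≢0 : NonZero p
    p≢0 = prime⇒nonZero pp

  1<p : 1 < p
  1<p = nonTrivial⇒n>1 p {{prime⇒nonTrivial pp}}

  val-intro : ∀ e u → ¬ p ∣ u → IsValuation p (p ^ e * u) e
  val-intro e u p∤u = m∣m*n u , λ pᵉ⁺¹∣ → p∤u (*-cancelʳ-∣ (p ^ e) {{m^n≢0 p e}} (subst (p * p ^ e ∣_) (*-comm (p ^ e) u) pᵉ⁺¹∣))

  val-elim : ∀ {x} e → IsValuation p x e → Σ[ u ∈ ℕ ] x ≡ p ^ e * u × ¬ p ∣ u
  val-elim {x} e (divides u x≡u*pᵉ , pᵉ⁺¹∤x) = u , trans x≡u*pᵉ (*-comm u (p ^ e)) , p∤u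
    where
    p∤u : ¬ p ∣ u
    p∤u (divides j u≡j*p) = pᵉ⁺¹∤x (divides j (trans x≡u*pᵉ (trans (cong (_* p ^ e) u≡j*p) (*-assoc j p (p ^ e)))))

  val0 : ∀ {x} → ¬ p ∣ x → IsValuation p x 0
  val0 {x} p∤x = subst (λ t → IsValuation p t 0) (+-identityʳ x) (val-intro 0 x p∤x)

  val0⇒∤ : ∀ {x} → IsValuation p x 0 → ¬ p ∣ x
  val0⇒∤ (_ , p¹∤x) p∣x = p¹∤x (subst (_∣ _) (sym (*-identityʳ p)) p∣x)

  val-suc⇒∣ : ∀ {x} e → IsValuation p x (suc e) → p ∣ x
  val-suc⇒∣ e (pᵉ⁺¹∣x , _) = ∣-trans (m∣m*n (p ^ e)) pᵉ⁺¹∣x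

  val-pos : ∀ {x} e → IsValuation p x e → 0 < x
  val-pos {zero} e (_ , pᵉ⁺¹∤0) = ⊥-elim (pᵉ⁺¹∤0 (_ ∣0))
  val-pos {suc x} e _ = s≤s z≤n

  val-unique : ∀ {x} a b → IsValuation p x a → IsValuation p x b → a ≡ b
  val-unique {x} a b (pᵃ∣x , pᵃ⁺¹∤x) (pᵇ∣x , pᵇ⁺¹∤x) with <-cmp a b
  ... | tri≈ _ a≡b _ = a≡b
  ... | tri< a<b _ _ = ⊥-elim (pᵃ⁺¹∤x (∣-trans (p^m∣p^n p a<b) pᵇ∣x))
  ... | tri> _ _ a>b = ⊥-elim (pᵇ⁺¹∤x (∣-trans (p^m∣p^n p a>b) pᵃ∣x))

  val-mul : ∀ {x y} a b → IsValuation p x a → IsValuation p y b → IsValuation p (x * y) (a + b)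
  val-mul {x} {y} a b νx νy with val-elim a νx | val-elim b νy
  ... | u , x≡ , p∤u | w , y≡ , p∤w = subst (λ t → IsValuation p t (a + b)) (sym xy≡) (val-intro (a + b) (u * w) p∤uw)
    where
    xy≡ : x * y ≡ p ^ (a + b) * (u * w)
    xy≡ = trans (cong₂ _*_ x≡ y≡) (trans (regroup (p ^ a) u (p ^ b) w) (cong (_* (u * w)) (sym (^-distribˡ-+-* p a b))))
      where regroup : ∀ A u B w → A * u * (B * w) ≡ A * B * (u * w)
            regroup = solve-∀
    p∤uw : ¬ p ∣ u * w
    p∤uw p∣uw = [ p∤u , p∤w ]′ (euclidsLemma u w pp p∣uw)

  val-p : IsValuation p p 1
  val-p = subst (λ t → IsValuation p t 1) (trans (*-identityʳ _) (*-identityʳ p)) (val-intro 1 1 (prime∤1 pp))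

  val-*p : ∀ {x} e → IsValuation p x e → IsValuation p (x * p) (suc e)
  val-*p e νx = subst (IsValuation p _) (+-comm e 1) (val-mul e 1 νx val-p)

  val-exists : ∀ x → 0 < x → Σ ℕ (IsValuation p x)
  val-exists = <-rec _ step
    where
    step : ∀ x → (∀ {y} → y < x → 0 < y → Σ ℕ (IsValuation p y)) → 0 < x → Σ ℕ (IsValuation p x)
    step x rec x>0 with p ∣? x
    ... | no p∤x = 0 , val0 p∤x
    ... | yes (divides k x≡k*p) = suc e , subst (λ t → IsValuation p t (suc e)) (sym x≡k*p) (val-*p e νk)
      where
      k>0 : 0 < k
      k>0 = n≢0⇒n>0 (λ k≡0 → <⇒≢ x>0 (sym (trans x≡k*p (cong (_* p) k≡0))))
      k<x : k < x
      k<x = subst (k <_) (sym x≡k*p) (m<m*n k p {{>-nonZero k>0}} 1<p)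
      e = proj₁ (rec k<x k>0)
      νk = proj₂ (rec k<x k>0)

  val-add : ∀ {A B} e → IsValuation p A e → p ^ suc e ∣ B → IsValuation p (A + B) e
  val-add {A} {B} e (pᵉ∣A , pᵉ⁺¹∤A) pᵉ⁺¹∣B =
    ∣m∣n⇒∣m+n pᵉ∣A (∣-trans (p^m∣p^n p (n≤1+n e)) pᵉ⁺¹∣B) , λ pᵉ⁺¹∣A+B → pᵉ⁺¹∤A (∣m+n∣m⇒∣n (subst (p ^ suc e ∣_) (+-comm A B) pᵉ⁺¹∣A+B) pᵉ⁺¹∣B)

  val-cancel : ∀ {x y} e → ¬ p ∣ x → IsValuation p (x * y) e → IsValuation p y e
  val-cancel {x} {y} e p∤x νxy = subst (IsValuation p y) (val-unique (0 + e′) e (val-mul 0 e′ (val0 p∤x) νy) νxy) νy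
    where
    y>0 : 0 < y
    y>0 = n≢0⇒n>0 (λ y≡0 → <⇒≢ (val-pos e νxy) (sym (trans (cong (x *_) y≡0) (*-zeroʳ x))))
    e′ = proj₁ (val-exists y y>0)
    νy = proj₂ (val-exists y y>0)

  pow-coprime : ∀ {z} → ¬ p ∣ z → ∀ v x → p ^ v ∣ x * z → p ^ v ∣ x
  pow-coprime p∤z zero x _ = 1∣ x
  pow-coprime {z} p∤z (suc v) x pᵛ⁺¹∣xz with euclidsLemma x z pp (∣-trans (m∣m*n (p ^ v)) pᵛ⁺¹∣xz)
  ... | inj₂ p∣z = ⊥-elim (p∤z p∣z)
  ... | inj₁ (divides x′ refl) = subst (_∣ x′ * p) (*-comm (p ^ v) p) (*-monoˡ-∣ p (pow-coprime p∤z v x′ pᵛ∣x′z))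
    where
    pᵛ∣x′z : p ^ v ∣ x′ * z
    pᵛ∣x′z = *-cancelˡ-∣ p (subst (p * p ^ v ∣_) (reorder x′ p z) pᵛ⁺¹∣xz)
      where reorder : ∀ x p z → x * p * z ≡ p * (x * z)
            reorder = solve-∀

  val-mono : ∀ {x y a b} → x ∣ y → IsValuation p x a → IsValuation p y b → a ≤ b
  val-mono x∣y (pᵃ∣x , _) (_ , pᵇ⁺¹∤y) = ≮⇒≥ λ b<a → pᵇ⁺¹∤y (∣-trans (p^m∣p^n p b<a) (∣-trans pᵃ∣x x∣y))

  pow-∣-* : ∀ a b {x y} → p ^ a ∣ x → p ^ b ∣ y → p ^ (a + b) ∣ x * y
  pow-∣-* a b pᵃ∣x pᵇ∣y = subst (_∣ _) (sym (^-distribˡ-+-* p a b)) (*-pres-∣ pᵃ∣x pᵇ∣y)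

  pow-∣-weaken : ∀ {a b x} → a ≤ b → p ^ b ∣ x → p ^ a ∣ x
  pow-∣-weaken a≤b pᵇ∣x = ∣-trans (p^m∣p^n p a≤b) pᵇ∣x

  ∤-pow : ∀ {w} j → ¬ p ∣ w → ¬ p ∣ w ^ j
  ∤-pow zero p∤w = prime∤1 pp
  ∤-pow {w} (suc j) p∤w p∣wʲ⁺¹ = [ p∤w , ∤-pow j p∤w ]′ (euclidsLemma w (w ^ j) pp p∣wʲ⁺¹)

module DigitSum (q : ℕ) (q≥1 : 1 ≤ q) where
  p : ℕ
  p = suc q

  1<p : 1 < p
  1<p = s≤s q≥1

  ds : ℕ → ℕ
  ds n = digitSum p n

  private
    fuel-zero : ∀ f → digitSumFuel f p 0 ≡ 0
    fuel-zero zero = refl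
    fuel-zero (suc f) = fuel-zero f

    quot≤ : ∀ n f → n ≤ suc f → n / p ≤ f
    quot≤ zero f _ = z≤n
    quot≤ n@(suc _) f n≤1+f = ≤-pred (≤-trans (m/n<m n p 1<p) n≤1+f)

    fuel-irrelevant : ∀ f g n → n ≤ f → n ≤ g → digitSumFuel f p n ≡ digitSumFuel g p n
    fuel-irrelevant zero g .0 z≤n _ = sym (fuel-zero g)
    fuel-irrelevant (suc f) zero .0 _ z≤n = fuel-zero (suc f)
    fuel-irrelevant (suc f) (suc g) n n≤f n≤g = cong (n % p +_) (fuel-irrelevant f g (n / p) (quot≤ n f n≤f) (quot≤ n g n≤g))

  ds-split : ∀ n → ds n ≡ n % p + ds (n / p)
  ds-split zero = refl
  ds-split (suc n) = cong (suc n % p +_) (fuel-irrelevant n (suc n / p) (suc n / p) (quot≤ (suc n) n ≤-refl) ≤-refl)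

  ds-digit : ∀ x d → d < p → ds (d + x * p) ≡ d + ds x
  ds-digit x d d<p = trans (ds-split (d + x * p))
    (cong₂ (λ a b → a + ds b) (proj₁ (divmod-unique x d d<p)) (proj₂ (divmod-unique x d d<p)))

  ds-1 : ds 1 ≡ 1
  ds-1 = ds-digit 0 1 1<p

  ds-p^ : ∀ v x → ds (p ^ v * x) ≡ ds x
  ds-p^ zero x = cong ds (+-identityʳ x)
  ds-p^ (suc v) x = begin
    ds (p * p ^ v * x)   ≡⟨ cong ds (trans (*-assoc p (p ^ v) x) (*-comm p (p ^ v * x))) ⟩
    ds (p ^ v * x * p)   ≡⟨ ds-digit (p ^ v * x) 0 (s≤s z≤n) ⟩
    ds (p ^ v * x)       ≡⟨ ds-p^ v x ⟩
    ds x                 ∎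
    where open ≡-Reasoning

  module _ (pp : Prime p) where
    open Valuation pp using (val0; val-*p; val-mul; val-mono)

    -- (p − 1)·ν(j + 1) + s(j + 1) = s(j) + 1: adding one to j turns its
    -- ν(j+1) trailing digits p − 1 into zeros.
    val-suc : ∀ j → Σ[ u ∈ ℕ ] IsValuation p (suc j) u × q * u + ds (suc j) ≡ ds j + 1
    val-suc = <-rec _ step
      where
      step : ∀ j → (∀ {i} → i < j → Σ[ u ∈ ℕ ] IsValuation p (suc i) u × q * u + ds (suc i) ≡ ds i + 1) →
             Σ[ u ∈ ℕ ] IsValuation p (suc j) u × q * u + ds (suc j) ≡ ds j + 1
      step j rec = by-digits (suc j % p) (suc j / p) (m≡m%n+[m/n]*n (suc j) p) (m%n<n (suc j) p)
        where
        by-digits : ∀ r Q → suc j ≡ r + Q * p → r < p → Σ[ u ∈ ℕ ] IsValuation p (suc j) u × q * u + ds (suc j) ≡ ds j + 1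
        by-digits (suc d) Q 1+j≡ d<p = 0 , val0 p∤1+j , (begin
          q * 0 + ds (suc j)                 ≡⟨ cong₂ (λ a b → a + ds b) (*-zeroʳ q) 1+j≡ ⟩
          ds (suc d + Q * p)                 ≡⟨ ds-digit Q (suc d) d<p ⟩
          suc d + ds Q                       ≡⟨ +-comm 1 (d + ds Q) ⟩
          d + ds Q + 1                       ≡⟨ cong (_+ 1) (sym (trans (cong ds (suc-injective 1+j≡)) (ds-digit Q d (<⇒≤ d<p)))) ⟩
          ds j + 1                           ∎)
          where
          open ≡-Reasoning
          p∤1+j : ¬ p ∣ suc j
          p∤1+j p∣1+j = 0≢1+n (trans (sym (n∣m⇒m%n≡0 _ p (subst (p ∣_) 1+j≡ p∣1+j))) (proj₁ (divmod-unique Q (suc d) d<p)))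
        by-digits zero zero () _
        by-digits zero (suc Q′) 1+j≡ _ = suc u , subst (λ t → IsValuation p t (suc u)) (sym 1+j≡) (val-*p u νQ) , (begin
          q * suc u + ds (suc j)             ≡⟨ cong (λ t → q * suc u + ds t) 1+j≡ ⟩
          q * suc u + ds (suc Q′ * p)        ≡⟨ cong (q * suc u +_) (ds-digit (suc Q′) 0 (s≤s z≤n)) ⟩
          q * suc u + ds (suc Q′)            ≡⟨ cong (_+ ds (suc Q′)) (*-suc q u) ⟩
          q + q * u + ds (suc Q′)            ≡⟨ +-assoc q (q * u) _ ⟩
          q + (q * u + ds (suc Q′))          ≡⟨ cong (q +_) ih ⟩
          q + (ds Q′ + 1)                    ≡⟨ sym (+-assoc q (ds Q′) 1) ⟩
          q + ds Q′ + 1                      ≡⟨ cong (_+ 1) (sym (trans (cong ds j≡) (ds-digit Q′ q ≤-refl))) ⟩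
          ds j + 1                           ∎)
          where
          open ≡-Reasoning
          j≡ : j ≡ q + Q′ * p
          j≡ = suc-injective 1+j≡
          Q′<j : Q′ < j
          Q′<j = subst (Q′ <_) (sym j≡) (<-≤-trans (m<n+m Q′ q≥1) (+-monoʳ-≤ q (m≤m*n Q′ p)))
          u = proj₁ (rec Q′<j)
          νQ = proj₁ (proj₂ (rec Q′<j))
          ih = proj₂ (proj₂ (rec Q′<j))

    legendre : ∀ m → Σ[ E ∈ ℕ ] IsValuation p (m !) E × q * E + ds m ≡ m
    legendre zero = 0 , val0 (prime∤1 pp) , trans (+-identityʳ (q * 0)) (*-zeroʳ q)
    legendre (suc m) with legendre m | val-suc m
    ... | E , νm! , eq | u , ν1+m , eq′ = u + E , val-mul u E ν1+m νm! , (begin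
      q * (u + E) + ds (suc m)     ≡⟨ cong (_+ ds (suc m)) (*-distribˡ-+ q u E) ⟩
      q * u + q * E + ds (suc m)   ≡⟨ regroup (q * u) (q * E) (ds (suc m)) ⟩
      q * E + (q * u + ds (suc m)) ≡⟨ cong (q * E +_) eq′ ⟩
      q * E + (ds m + 1)           ≡⟨ sym (+-assoc (q * E) (ds m) 1) ⟩
      q * E + ds m + 1             ≡⟨ cong (_+ 1) eq ⟩
      m + 1                        ≡⟨ +-comm m 1 ⟩
      suc m                        ∎)
      where
      open ≡-Reasoning
      regroup : ∀ a b c → a + b + c ≡ b + (a + c)
      regroup = solve-∀

    -- s(a + b) ≤ s(a) + s(b): compare Legendre's formula for (a + b)! and for
    -- a!·b!, which divides it.
    ds-subadditive : ∀ a b → ds (a + b) ≤ ds a + ds b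
    ds-subadditive a b with legendre a | legendre b | legendre (a + b)
    ... | Ea , νa! , eqa | Eb , νb! , eqb | E , νab! , eq = +-cancelˡ-≤ (q * E) _ _ (begin
      q * E + ds (a + b)                 ≡⟨ eq ⟩
      a + b                              ≡⟨ cong₂ _+_ (sym eqa) (sym eqb) ⟩
      q * Ea + ds a + (q * Eb + ds b)    ≡⟨ regroup q Ea Eb (ds a) (ds b) ⟩
      q * (Ea + Eb) + (ds a + ds b)      ≤⟨ +-monoˡ-≤ (ds a + ds b) (*-monoʳ-≤ q Ea+Eb≤E) ⟩
      q * E + (ds a + ds b)              ∎)
      where
      open ≤-Reasoning
      a!b!∣[a+b]! : a ! * b ! ∣ (a + b) !
      a!b!∣[a+b]! = subst (λ t → a ! * t ! ∣ (a + b) !) (m+n∸m≡n a b) (k![n∸k]!∣n! (m≤m+n a b))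
      Ea+Eb≤E : Ea + Eb ≤ E
      Ea+Eb≤E = val-mono a!b!∣[a+b]! (val-mul Ea Eb νa! νb!) νab!
      regroup : ∀ q x y a b → q * x + a + (q * y + b) ≡ q * (x + y) + (a + b)
      regroup = solve-∀

    -- If the last digit of Y + W is smaller than that of Y, the addition
    -- carried, and a carry strictly lowers the digit sum.
    ds-carry : ∀ Y W → (Y + W) % p < Y % p → ds (Y + W) < ds Y + ds W
    ds-carry Y W last< with add-digits p Y W
    ... | inj₁ (_ , last≡ , _) = ⊥-elim (<⇒≱ last< (subst (Y % p ≤_) (sym last≡) (m≤m+n _ _)))
    ... | inj₂ (digits≡ , quot≡) = begin-strict
      ds (Y + W)                                     ≡⟨ ds-split (Y + W) ⟩
      (Y + W) % p + ds ((Y + W) / p)                 ≡⟨ cong (λ t → (Y + W) % p + ds t) quot≡ ⟩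
      (Y + W) % p + ds (1 + (Y / p + W / p))         ≤⟨ +-monoʳ-≤ ((Y + W) % p) (ds-subadditive 1 _) ⟩
      (Y + W) % p + (ds 1 + ds (Y / p + W / p))      ≤⟨ +-monoʳ-≤ ((Y + W) % p) (+-mono-≤ (≤-reflexive ds-1) (ds-subadditive (Y / p) (W / p))) ⟩
      (Y + W) % p + (1 + (ds (Y / p) + ds (W / p)))  <⟨ +-monoʳ-< ((Y + W) % p) (+-monoˡ-< _ 1<p) ⟩
      (Y + W) % p + (p + (ds (Y / p) + ds (W / p)))  ≡⟨ sym (+-assoc ((Y + W) % p) p _) ⟩
      (Y + W) % p + p + (ds (Y / p) + ds (W / p))    ≡⟨ cong (_+ (ds (Y / p) + ds (W / p))) (sym digits≡) ⟩
      Y % p + W % p + (ds (Y / p) + ds (W / p))      ≡⟨ regroup (Y % p) (W % p) (ds (Y / p)) (ds (W / p)) ⟩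
      (Y % p + ds (Y / p)) + (W % p + ds (W / p))    ≡⟨ sym (cong₂ _+_ (ds-split Y) (ds-split W)) ⟩
      ds Y + ds W                                    ∎
      where
      open ≤-Reasoning
      regroup : ∀ a b c d → a + b + (c + d) ≡ (a + c) + (b + d)
      regroup = solve-∀

tri : ℕ → ℕ
tri zero = 0
tri (suc j) = tri j + j

-- 2T(j) + j = j², so that p ∣ T(p) for odd p.
2·tri : ∀ j → tri j * 2 + j ≡ j * j
2·tri zero = refl
2·tri (suc j) = trans (expand (tri j) j) (trans (cong (λ t → t + j + j + 1) (2·tri j)) (square j))
  where expand : ∀ t j → (t + j) * 2 + suc j ≡ t * 2 + j + j + j + 1
        expand = solve-∀
        square : ∀ j → j * j + j + j + 1 ≡ suc j * suc j
        square = solve-∀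

module FibExpansion (m′ : ℕ) where
  m u w : ℕ
  m = suc m′
  u = fib m
  w = fib m′

  A B : ℕ → ℕ
  A j = fib (j * m)
  B j = fib (suc (j * m))

  expansion : ∀ j → (Σ[ c ∈ ℕ ] w * B j ≡ w * w ^ j + j * u * w ^ j + c * (u * u))
                  × (Σ[ c ∈ ℕ ] w * w * A j ≡ j * u * (w * w ^ j) + tri j * (u * u) * w ^ j + c * (u * u * u))
  expansion zero = (0 , base₁ w u) , (0 , base₂ w)
    where base₁ : ∀ w u → w * 1 ≡ w * 1 + 0 * u * 1 + 0 * (u * u)
          base₁ = solve-∀
          base₂ : ∀ w → w * w * 0 ≡ 0
          base₂ = solve-∀
  expansion (suc j) with expansion j | fib∣fib-multiple m j
  ... | (c₁ , wB≡) , (c₂ , wwA≡) | divides d A≡d·u = (c₁′ , wB′≡) , (c₂′ , wwA′≡)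
    where
    W = w ^ j
    c₁′ = j * W + c₁ * (u + w) + w * d
    c₂′ = w * c₁ + w * c₂
    A-rec : A (suc j) ≡ u * B j + w * A j
    A-rec = fib-add m′ (j * m)
    B-rec : B (suc j) ≡ (u + w) * B j + u * A j
    B-rec = fib-add m (j * m)
    wB′≡ : w * B (suc j) ≡ w * (w * W) + suc j * u * (w * W) + c₁′ * (u * u)
    wB′≡ = begin
      w * B (suc j)                                          ≡⟨ cong (w *_) B-rec ⟩
      w * ((u + w) * B j + u * A j)                          ≡⟨ cong (λ t → w * ((u + w) * B j + u * t)) A≡d·u ⟩
      w * ((u + w) * B j + u * (d * u))                      ≡⟨ regroup w u (B j) d ⟩
      (u + w) * (w * B j) + u * u * w * d                    ≡⟨ cong (λ t → (u + w) * t + u * u * w * d) wB≡ ⟩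
      (u + w) * (w * W + j * u * W + c₁ * (u * u)) + u * u * w * d ≡⟨ collect u w W j c₁ d ⟩
      w * (w * W) + suc j * u * (w * W) + c₁′ * (u * u)      ∎
      where
      open ≡-Reasoning
      regroup : ∀ w u B d → w * ((u + w) * B + u * (d * u)) ≡ (u + w) * (w * B) + u * u * w * d
      regroup = solve-∀
      collect : ∀ u w W j c₁ d → (u + w) * (w * W + j * u * W + c₁ * (u * u)) + u * u * w * d
                               ≡ w * (w * W) + suc j * u * (w * W) + (j * W + c₁ * (u + w) + w * d) * (u * u)
      collect = solve-∀
    wwA′≡ : w * w * A (suc j) ≡ suc j * u * (w * (w * W)) + tri (suc j) * (u * u) * (w * W) + c₂′ * (u * u * u)
    wwA′≡ = begin
      w * w * A (suc j)                                      ≡⟨ cong (w * w *_) A-rec ⟩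
      w * w * (u * B j + w * A j)                            ≡⟨ regroup w u (B j) (A j) ⟩
      u * w * (w * B j) + w * (w * w * A j)                  ≡⟨ cong₂ (λ x y → u * w * x + w * y) wB≡ wwA≡ ⟩
      u * w * (w * W + j * u * W + c₁ * (u * u)) + w * (j * u * (w * W) + tri j * (u * u) * W + c₂ * (u * u * u))
                                                             ≡⟨ collect u w j W c₁ c₂ (tri j) ⟩
      suc j * u * (w * (w * W)) + tri (suc j) * (u * u) * (w * W) + c₂′ * (u * u * u) ∎
      where
      open ≡-Reasoning
      regroup : ∀ w u B A → w * w * (u * B + w * A) ≡ u * w * (w * B) + w * (w * w * A)
      regroup = solve-∀
      collect : ∀ u w j W c₁ c₂ t → u * w * (w * W + j * u * W + c₁ * (u * u)) + w * (j * u * (w * W) + t * (u * u) * W + c₂ * (u * u * u))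
                                  ≡ suc j * u * (w * (w * W)) + (t + j) * (u * u) * (w * W) + (w * c₁ + w * c₂) * (u * u * u)
      collect = solve-∀

module FibLTE {p : ℕ} (pp : Prime p) (m′ f′ : ℕ) (νu : IsValuation p (fib (suc m′)) (suc f′)) where
  open Valuation pp
  open FibExpansion m′

  f : ℕ
  f = suc f′

  p∣u : p ∣ u
  p∣u = val-suc⇒∣ f′ νu

  p∤w : ¬ p ∣ w
  p∤w p∣w = prime∤1 pp (fib-consecutive-coprime m′ p∣w p∣u)

  p∤w² : ¬ p ∣ w * w
  p∤w² p∣w² = [ p∤w , p∤w ]′ (euclidsLemma w w pp p∣w²)

  1≤f : 1 ≤ f
  1≤f = s≤s z≤n

  -- the higher terms of the expansion are divisible by u², and p^{f+1} ∣ u²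
  pᶠ⁺¹∣u² : p ^ suc f ∣ u * u
  pᶠ⁺¹∣u² = pow-∣-weaken (+-monoˡ-≤ f 1≤f) (pow-∣-* f f (proj₁ νu) (proj₁ νu))

  val-leading : ∀ {j} e → IsValuation p j e → IsValuation p (j * u * (w * w ^ j)) (e + f)
  val-leading {j} e νj = subst (IsValuation p _) (+-identityʳ (e + f))
    (val-mul (e + f) (0 + 0) (val-mul e f νj νu) (val-mul 0 0 (val0 p∤w) (val0 (∤-pow j p∤w))))

  -- for p ∤ j the leading term has valuation f and the others more
  val-A-coprime : ∀ j → ¬ p ∣ j → IsValuation p (A j) f
  val-A-coprime j p∤j with proj₂ (expansion j)
  ... | c , wwA≡ = val-cancel f p∤w² (subst (λ t → IsValuation p t f) (sym wwA≡) ν-expansion)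
    where
    ν-expansion : IsValuation p (j * u * (w * w ^ j) + tri j * (u * u) * w ^ j + c * (u * u * u)) f
    ν-expansion = val-add f (val-add f (val-leading 0 (val0 p∤j))
                                       (∣-trans pᶠ⁺¹∣u² (∣-trans (n∣m*n (tri j)) (m∣m*n (w ^ j)))))
                            (∣-trans pᶠ⁺¹∣u² (∣-trans (m∣m*n u) (n∣m*n c)))

  -- for j = p the leading term has valuation f + 1, and for odd p the others more
  val-A-p : p ≢ 2 → IsValuation p (A p) (suc f)
  val-A-p p≢2 with proj₂ (expansion p)
  ... | c , wwA≡ = val-cancel (suc f) p∤w² (subst (λ t → IsValuation p t (suc f)) (sym wwA≡) ν-expansion)
    where
    -- 2·T(p) = p(p − 1), so p ∣ T(p) for odd p
    p∣T[p] : p ∣ tri p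
    p∣T[p] with euclidsLemma (tri p) 2 pp (∣m+n∣m⇒∣n (subst (p ∣_) (trans (sym (2·tri p)) (+-comm _ p)) (m∣m*n p)) ∣-refl)
    ... | inj₁ p∣T = p∣T
    ... | inj₂ p∣2 = ⊥-elim (p≢2 (≤-antisym (∣⇒≤ p∣2) (nonTrivial⇒n>1 p {{prime⇒nonTrivial pp}})))
    pᶠ⁺²∣T·u² : p ^ suc (suc f) ∣ tri p * (u * u)
    pᶠ⁺²∣T·u² = pow-∣-* 1 (suc f) (subst (_∣ tri p) (sym (*-identityʳ p)) p∣T[p]) pᶠ⁺¹∣u²
    pᶠ⁺²∣u³ : p ^ suc (suc f) ∣ u * u * u
    pᶠ⁺²∣u³ = pow-∣-weaken (+-monoˡ-≤ f (+-mono-≤ 1≤f 1≤f)) (pow-∣-* (f + f) f (pow-∣-* f f (proj₁ νu) (proj₁ νu)) (proj₁ νu))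
    ν-expansion : IsValuation p (p * u * (w * w ^ p) + tri p * (u * u) * w ^ p + c * (u * u * u)) (suc f)
    ν-expansion = val-add (suc f) (val-add (suc f) (val-leading 1 val-p) (∣-trans pᶠ⁺²∣T·u² (m∣m*n (w ^ p))))
                                  (∣-trans pᶠ⁺²∣u³ (n∣m*n c))

module FibonacciValuation (q : ℕ) (q≥1 : 1 ≤ q) (pp : Prime (suc q)) (p≢2 : suc q ≢ 2)
                          (z′ : ℕ) (R : IsRankOfAppearance (suc q) (suc z′))
                          (e′ : ℕ) (νFz : IsValuation (suc q) (fib (suc z′)) (suc e′)) where
  open DigitSum q q≥1
  open Valuation pp hiding (1<p)
  open Rank pp R using (p∤F[jz+ρ])

  z e : ℕ
  z = suc z′
  e = suc e′

  val-F[Jz] : ∀ J u → IsValuation p (suc J) u → IsValuation p (fib (suc J * z)) (e + u)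
  val-F[Jz] = <-rec _ step
    where
    step : ∀ J → (∀ {I} → I < J → ∀ u → IsValuation p (suc I) u → IsValuation p (fib (suc I * z)) (e + u)) →
           ∀ u → IsValuation p (suc J) u → IsValuation p (fib (suc J * z)) (e + u)
    step J rec u ν1+J with p ∣? suc J
    ... | no p∤1+J = subst (IsValuation p _) (trans (sym (+-identityʳ e)) (cong (e +_) (val-unique 0 u (val0 p∤1+J) ν1+J)))
                       (FibLTE.val-A-coprime pp z′ e′ νFz (suc J) p∤1+J)
    ... | yes (divides zero 1+J≡) = ⊥-elim (1+n≢0 1+J≡)
    ... | yes (divides (suc I) 1+J≡) = subst (IsValuation p (fib (suc J * z))) exponent≡ ν-result
      where
      v = proj₁ (val-exists (suc I) (s≤s z≤n))
      ν1+I = proj₂ (val-exists (suc I) (s≤s z≤n))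
      I<J : I < J
      I<J = ≤-pred (≤-trans (s≤s (s≤s (m≤m*n I 2))) (≤-trans (*-monoʳ-≤ (suc I) 1<p) (≤-reflexive (sym 1+J≡))))
      k = I * z + z′
      [1+I]z≡ : suc I * z ≡ suc k
      [1+I]z≡ = trans (+-comm z (I * z)) (+-suc (I * z) z′)
      ν-inner : IsValuation p (fib (suc k)) (suc (e′ + v))
      ν-inner = subst (λ t → IsValuation p (fib t) (e + v)) [1+I]z≡ (rec I<J v ν1+I)
      [1+J]z≡ : suc J * z ≡ p * suc k
      [1+J]z≡ = begin
        suc J * z          ≡⟨ cong (_* z) 1+J≡ ⟩
        suc I * p * z      ≡⟨ reorder (suc I) p z ⟩
        p * (suc I * z)    ≡⟨ cong (p *_) [1+I]z≡ ⟩
        p * suc k          ∎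
        where
        open ≡-Reasoning
        reorder : ∀ a p z → a * p * z ≡ p * (a * z)
        reorder = solve-∀
      ν-result : IsValuation p (fib (suc J * z)) (suc (suc (e′ + v)))
      ν-result = subst (λ t → IsValuation p (fib t) (suc (suc (e′ + v)))) (sym [1+J]z≡) (FibLTE.val-A-p pp k (e′ + v) ν-inner p≢2)
      exponent≡ : suc (suc (e′ + v)) ≡ e + u
      exponent≡ = trans (cong suc (sym (+-suc e′ v)))
                        (cong (e +_) (val-unique (1 + v) u (subst (λ t → IsValuation p t (1 + v)) (trans (*-comm p (suc I)) (sym 1+J≡)) (val-mul 1 v val-p ν1+I)) ν1+J))

  -- The increment of (p − 1)·ν over one block of z consecutive factors.
  K : ℕ
  K = q * e + 1

  -- Legendre-type formula for F(1)⋯F(m), proved block by block: the invariant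
  -- (p − 1)·ν(F(1)⋯F(Qz + ρ)) + s(Q) = K·Q for 0 ≤ ρ < z.
  private
    Invariant : ℕ → ℕ → Set
    Invariant Q ρ = Σ[ E ∈ ℕ ] IsValuation p (fibProd (Q * z + ρ)) E × q * E + ds Q ≡ K * Q

    -- the factors F(Qz + 1), …, F(Qz + ρ) with ρ < z are prime to p
    within-block : ∀ Q ρ → ρ < z → Invariant Q 0 → Invariant Q ρ
    within-block Q zero _ inv = inv
    within-block Q (suc ρ) ρ<z inv with within-block Q ρ (<⇒≤ ρ<z) inv
    ... | E , νE , eq = E + 0 , subst (λ t → IsValuation p t (E + 0)) (sym (cong fibProd idx≡)) (val-mul E 0 νE (val0 p∤F))
                            , trans (cong (λ t → q * t + ds Q) (+-identityʳ E)) eq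
      where
      idx≡ : Q * z + suc ρ ≡ suc (Q * z + ρ)
      idx≡ = +-suc (Q * z) ρ
      p∤F : ¬ p ∣ fib (suc (Q * z + ρ))
      p∤F p∣F = p∤F[jz+ρ] Q (suc ρ) (s≤s z≤n) ρ<z (subst (λ t → p ∣ fib t) (sym idx≡) p∣F)

    -- the factor F((Q + 1)z) contributes e + ν(Q + 1)
    next-block : ∀ Q → Invariant Q z′ → Invariant (suc Q) 0
    next-block Q (E , νE , eq) with val-suc pp Q
    ... | u , ν1+Q , eq′ = E + (e + u) , subst (λ t → IsValuation p t (E + (e + u))) (sym prod≡) (val-mul E (e + u) νE (val-F[Jz] Q u ν1+Q))
                                       , (begin
      q * (E + (e + u)) + ds (suc Q)      ≡⟨ regroup q E e u (ds (suc Q)) ⟩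
      q * E + q * e + (q * u + ds (suc Q)) ≡⟨ cong (q * E + q * e +_) eq′ ⟩
      q * E + q * e + (ds Q + 1)          ≡⟨ regroup′ (q * E) (q * e) (ds Q) ⟩
      (q * E + ds Q) + K                  ≡⟨ cong (_+ K) eq ⟩
      K * Q + K                           ≡⟨ trans (+-comm (K * Q) K) (sym (*-suc K Q)) ⟩
      K * suc Q                           ∎)
      where
      open ≡-Reasoning
      idx≡ : suc Q * z + 0 ≡ suc (Q * z + z′)
      idx≡ = trans (+-identityʳ _) (trans (+-comm z (Q * z)) (+-suc (Q * z) z′))
      prod≡ : fibProd (suc Q * z + 0) ≡ fibProd (Q * z + z′) * fib (suc Q * z)
      prod≡ = trans (cong fibProd idx≡) (cong (λ t → fibProd (Q * z + z′) * fib t) (sym (trans (sym (+-identityʳ _)) idx≡)))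
      regroup : ∀ q E e u d → q * (E + (e + u)) + d ≡ q * E + q * e + (q * u + d)
      regroup = solve-∀
      regroup′ : ∀ a b c → a + b + (c + 1) ≡ (a + c) + (b + 1)
      regroup′ = solve-∀

    block-start : ∀ Q → Invariant Q 0
    block-start zero = 0 , val0 (prime∤1 pp) , trans (cong (_+ 0) (*-zeroʳ q)) (sym (*-zeroʳ K))
    block-start (suc Q) = next-block Q (within-block Q z′ ≤-refl (block-start Q))

  val-fibProd : ∀ m → Σ[ E ∈ ℕ ] IsValuation p (fibProd m) E × q * E + ds (m / z) ≡ K * (m / z)
  val-fibProd m with within-block (m / z) (m % z) (m%n<n m z) (block-start (m / z))
  ... | E , νE , eq = E , subst (λ t → IsValuation p (fibProd t) E) (sym (trans (m≡m%n+[m/n]*n m z) (+-comm (m % z) _))) νE , eq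

-- The Fibonomial coefficient (a+b choose a)_F, computed by the Pascal-type
-- recursion that the addition formula for F(a+b+2) induces on the quotient.
fibBinom : ℕ → ℕ → ℕ
fibBinom zero b = 1
fibBinom (suc a) zero = 1
fibBinom (suc a) (suc b) = fib (suc (suc b)) * fibBinom a (suc b) + fib a * fibBinom (suc a) b

fibBinom-prod : ∀ a b → fibProd (a + b) ≡ fibBinom a b * (fibProd a * fibProd b)
fibBinom-prod zero b = sym (trans (*-identityˡ _) (*-identityˡ _))
fibBinom-prod (suc a) zero = trans (cong fibProd (+-identityʳ (suc a))) (sym (trans (*-identityˡ _) (*-identityʳ _)))
fibBinom-prod (suc a) (suc b) = begin
    fibProd (suc (a + suc b))                         ≡⟨⟩
    P * fib (suc (a + suc b))                         ≡⟨ cong (P *_) (fib-add a (suc b)) ⟩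
    P * (Fa₁ * Fb₂ + Fa * Fb₁)                        ≡⟨ *-distribˡ-+ P (Fa₁ * Fb₂) (Fa * Fb₁) ⟩
    P * (Fa₁ * Fb₂) + P * (Fa * Fb₁)                  ≡⟨ cong₂ (λ x y → x * (Fa₁ * Fb₂) + y * (Fa * Fb₁)) ih₁ ih₂ ⟩
    G₁ * (Πa * (Πb * Fb₁)) * (Fa₁ * Fb₂) + G₂ * ((Πa * Fa₁) * Πb) * (Fa * Fb₁)
                                                      ≡⟨ collect G₁ G₂ Πa Πb Fa₁ Fb₁ Fb₂ Fa ⟩
    (Fb₂ * G₁ + Fa * G₂) * ((Πa * Fa₁) * (Πb * Fb₁))  ∎
  where
  open ≡-Reasoning
  P = fibProd (a + suc b)
  Fa₁ = fib (suc a)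
  Fa = fib a
  Fb₁ = fib (suc b)
  Fb₂ = fib (suc (suc b))
  Πa = fibProd a
  Πb = fibProd b
  G₁ = fibBinom a (suc b)
  G₂ = fibBinom (suc a) b
  ih₁ : P ≡ G₁ * (Πa * (Πb * Fb₁))
  ih₁ = fibBinom-prod a (suc b)
  ih₂ : P ≡ G₂ * ((Πa * Fa₁) * Πb)
  ih₂ = trans (cong fibProd (+-suc a b)) (fibBinom-prod (suc a) b)
  collect : ∀ G₁ G₂ Πa Πb Fa₁ Fb₁ Fb₂ Fa → G₁ * (Πa * (Πb * Fb₁)) * (Fa₁ * Fb₂) + G₂ * ((Πa * Fa₁) * Πb) * (Fa * Fb₁)
                                         ≡ (Fb₂ * G₁ + Fa * G₂) * ((Πa * Fa₁) * (Πb * Fb₁))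
  collect = solve-∀

fibonomial≡fibBinom : ∀ a b → fibonomial (a + b) a ≡ fibBinom a b
fibonomial≡fibBinom a b = begin
  fibonomial (a + b) a                       ≡⟨ cong (_/ D) (fibBinom-prod a b) ⟩
  fibBinom a b * (fibProd a * fibProd b) / D ≡⟨ cong (λ t → fibBinom a b * (fibProd a * fibProd t) / D) (sym (m+n∸m≡n a b)) ⟩
  fibBinom a b * D / D                       ≡⟨ m*n/n≡m (fibBinom a b) D ⟩
  fibBinom a b                             ∎
  where
  open ≡-Reasoning
  D = fibProd a * fibProd (a + b ∸ a)
  instance
    D≢0 : NonZero D
    D≢0 = >-nonZero (denomPos (a + b) a)

-- Base-z expansion of pʲn when z ∣ p + 1, i.e. p ≡ −1 (mod z): writing
-- n = s + Yz and t = s·(p + 1)/z, the quotients of p^{2k}n and p^{2k+1}n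
-- by z have digit sums s(Y) + kq and s(Y) + t + kq − 1 in base p = q + 1.
module PowerDigits (q : ℕ) (q≥1 : 1 ≤ q) (z′ g : ℕ) (p+1≡gz : suc (suc q) ≡ g * suc z′) where
  open DigitSum q q≥1

  z : ℕ
  z = suc z′

  t-bounds : ∀ ρ → 1 ≤ ρ → ρ < z → 1 ≤ ρ * g × ρ * g ≤ p
  t-bounds ρ ρ≥1 ρ<z = *-mono-≤ ρ≥1 g≥1 , ≤-pred (≤-trans (*-monoˡ-< g {{>-nonZero g≥1}} ρ<z) (≤-reflexive (trans (*-comm z g) (sym p+1≡gz))))
    where
    g≥1 : 1 ≤ g
    g≥1 = n≢0⇒n>0 (λ g≡0 → 1+n≢0 (trans p+1≡gz (cong (_* z) g≡0)))

  -- Multiplying ρ + Xz by p² = 1 + q(p + 1) keeps the remainder ρ; the new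
  -- quotient X·p² + ρgq gets the two extra digits p − ρg and ρg − 1.
  times-p² : ∀ ρ X → 1 ≤ ρ → ρ < z →
             (ρ + (X * p * p + ρ * g * q) * z ≡ p * p * (ρ + X * z)) × ds (X * p * p + ρ * g * q) ≡ ds X + q
  times-p² ρ X ρ≥1 ρ<z = expansion , digits (proj₂ (t-bounds ρ ρ≥1 ρ<z)) (proj₁ (t-bounds ρ ρ≥1 ρ<z))
    where
    expansion : ρ + (X * p * p + ρ * g * q) * z ≡ p * p * (ρ + X * z)
    expansion = begin
      ρ + (X * p * p + ρ * g * q) * z          ≡⟨ regroup ρ X p g q z ⟩
      ρ + X * p * p * z + ρ * q * (g * z)      ≡⟨ cong (λ t → ρ + X * p * p * z + ρ * q * t) (sym p+1≡gz) ⟩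
      ρ + X * p * p * z + ρ * q * suc (suc q)  ≡⟨ factor ρ X q z ⟩
      p * p * (ρ + X * z)                      ∎
      where
      open ≡-Reasoning
      regroup : ∀ ρ X p g q z → ρ + (X * p * p + ρ * g * q) * z ≡ ρ + X * p * p * z + ρ * q * (g * z)
      regroup = solve-∀
      factor : ∀ ρ X q z → ρ + X * suc q * suc q * z + ρ * q * suc (suc q) ≡ suc q * suc q * (ρ + X * z)
      factor = solve-∀
    digits : ρ * g ≤ p → 1 ≤ ρ * g → ds (X * p * p + ρ * g * q) ≡ ds X + q
    digits t≤p t≥1 with ρ * g
    ... | suc t′ = begin
      ds (X * p * p + suc t′ * q)     ≡⟨ cong ds (two-digits X t′ (q ∸ t′) q d+t′≡q) ⟩
      ds (d + (t′ + X * p) * p)       ≡⟨ ds-digit (t′ + X * p) d (s≤s (m∸n≤m q t′)) ⟩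
      d + ds (t′ + X * p)             ≡⟨ cong (d +_) (ds-digit X t′ t≤p) ⟩
      d + (t′ + ds X)                 ≡⟨ regroup d t′ (ds X) ⟩
      ds X + (d + t′)                 ≡⟨ cong (ds X +_) d+t′≡q ⟩
      ds X + q                        ∎
      where
      open ≡-Reasoning
      d = q ∸ t′
      d+t′≡q : d + t′ ≡ q
      d+t′≡q = m∸n+n≡m (≤-pred t≤p)
      two-digits : ∀ X t′ d q → d + t′ ≡ q → X * suc q * suc q + suc t′ * q ≡ d + (t′ + X * suc q) * suc q
      two-digits X t′ d .(d + t′) refl = expand X t′ d
        where expand : ∀ X t′ d → X * suc (d + t′) * suc (d + t′) + suc t′ * (d + t′) ≡ d + (t′ + X * suc (d + t′)) * suc (d + t′)
              expand = solve-∀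
      regroup : ∀ d t x → d + (t + x) ≡ x + (d + t)
      regroup = solve-∀

  -- If p ∣ ρ + Qz with 1 ≤ ρ < z, then ρg + (Q mod p) = p: multiplying by g
  -- turns z into p + 1 ≡ 1 (mod p), and p is the only multiple of p in [1, 2p).
  last-digit : ∀ ρ Q → 1 ≤ ρ → ρ < z → p ∣ ρ + Q * z → ρ * g + Q % p ≡ p
  last-digit ρ Q ρ≥1 ρ<z p∣ρ+Qz = only-multiple (≤-trans t≥1 (m≤m+n _ _)) (+-mono-≤-< t≤p (m%n<n Q p)) p∣sum
    where
    t≥1 = proj₁ (t-bounds ρ ρ≥1 ρ<z)
    t≤p = proj₂ (t-bounds ρ ρ≥1 ρ<z)
    [ρ+Qz]g≡ : (ρ + Q * z) * g ≡ (ρ * g + Q % p) + (Q / p + Q) * p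
    [ρ+Qz]g≡ = begin
      (ρ + Q * z) * g                      ≡⟨ regroup ρ Q z g ⟩
      ρ * g + Q * (g * z)                  ≡⟨ cong (λ t → ρ * g + Q * t) (sym p+1≡gz) ⟩
      ρ * g + Q * suc p                    ≡⟨ cong (λ t → ρ * g + t * suc p) (m≡m%n+[m/n]*n Q p) ⟩
      ρ * g + (Q % p + Q / p * p) * suc p  ≡⟨ expand (ρ * g) (Q % p) (Q / p) p ⟩
      (ρ * g + Q % p) + (Q / p + (Q % p + Q / p * p)) * p ≡⟨ cong (λ t → (ρ * g + Q % p) + (Q / p + t) * p) (sym (m≡m%n+[m/n]*n Q p)) ⟩
      (ρ * g + Q % p) + (Q / p + Q) * p    ∎
      where
      open ≡-Reasoning
      regroup : ∀ ρ Q z g → (ρ + Q * z) * g ≡ ρ * g + Q * (g * z)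
      regroup = solve-∀
      expand : ∀ t r d p → t + (r + d * p) * suc p ≡ (t + r) + (d + (r + d * p)) * p
      expand = solve-∀
    p∣sum : p ∣ ρ * g + Q % p
    p∣sum = ∣m+n∣m⇒∣n (subst (p ∣_) (+-comm _ ((Q / p + Q) * p)) (subst (p ∣_) [ρ+Qz]g≡ (∣-trans p∣ρ+Qz (m∣m*n g)))) (n∣m*n (Q / p + Q))
    only-multiple : ∀ {m} → 1 ≤ m → m < p + p → p ∣ m → m ≡ p
    only-multiple m≥1 _ (divides zero m≡0) = ⊥-elim (<⇒≢ m≥1 (sym m≡0))
    only-multiple _ _ (divides (suc zero) m≡p) = trans m≡p (+-identityʳ p)
    only-multiple m≥1 m<2p (divides (suc (suc c)) m≡) = ⊥-elim (<⇒≱ m<2p (subst (p + p ≤_) (sym m≡) (+-monoʳ-≤ p (m≤m+n p (c * p)))))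

  module _ (n s Y : ℕ) (n≡ : s + Y * z ≡ n) (s≥1 : 1 ≤ s) (s<z : s < z) where
    p^[2+2k]≡ : ∀ k → p ^ (2 * suc k) ≡ p * p * p ^ (2 * k)
    p^[2+2k]≡ k = trans (cong (p ^_) (double-suc k)) (sym (*-assoc p p _))
      where double-suc : ∀ k → 2 * suc k ≡ suc (suc (2 * k))
            double-suc = solve-∀

    even-power : ∀ k → Σ[ X ∈ ℕ ] (s + X * z ≡ p ^ (2 * k) * n) × ds X ≡ ds Y + k * q
    even-power zero = Y , trans n≡ (sym (*-identityˡ n)) , sym (+-identityʳ _)
    even-power (suc k) with even-power k
    ... | X , X≡ , dsX≡ = X * p * p + s * g * q
                        , trans (proj₁ step) (trans (cong (p * p *_) X≡) (trans (sym (*-assoc (p * p) (p ^ (2 * k)) n)) (cong (_* n) (sym (p^[2+2k]≡ k)))))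
                        , trans (proj₂ step) (trans (cong (_+ q) dsX≡) (regroup (ds Y) (k * q) q))
      where
      step = times-p² s X s≥1 s<z
      regroup : ∀ a b c → a + b + c ≡ a + (c + b)
      regroup = solve-∀

    odd-power : ∀ k → Σ[ X ∈ ℕ ] ((z ∸ s) + X * z ≡ p ^ suc (2 * k) * n) × ds X + 1 ≡ ds Y + s * g + k * q
    odd-power zero with s * g in sg≡ | t-bounds s s≥1 s<z
    ... | suc t′ | _ , t≤p = t′ + Y * p , expansion , (begin
      ds (t′ + Y * p) + 1        ≡⟨ cong (_+ 1) (ds-digit Y t′ t≤p) ⟩
      t′ + ds Y + 1              ≡⟨ regroup t′ (ds Y) ⟩
      ds Y + suc t′ + 0 * q      ∎)
      where
      open ≡-Reasoning
      regroup : ∀ t d → t + d + 1 ≡ d + suc t + 0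
      regroup = solve-∀
      -- (z − s) + t′z = p·s, because (z − s) + s + t′z = (1 + t′)z = sgz = s(p + 1)
      low : (z ∸ s) + t′ * z ≡ p * s
      low = +-cancelʳ-≡ s _ _ (begin
        (z ∸ s) + t′ * z + s  ≡⟨ swap (z ∸ s) t′ z s ⟩
        (z ∸ s + s) + t′ * z  ≡⟨ cong (_+ t′ * z) (m∸n+n≡m (<⇒≤ s<z)) ⟩
        suc t′ * z            ≡⟨ cong (_* z) (sym sg≡) ⟩
        s * g * z             ≡⟨ trans (*-assoc s g z) (cong (s *_) (sym p+1≡gz)) ⟩
        s * suc p             ≡⟨ trans (*-suc s p) (trans (+-comm s _) (cong (_+ s) (*-comm s p))) ⟩
        p * s + s             ∎)
        where swap : ∀ a t z s → a + t * z + s ≡ (a + s) + t * z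
              swap = solve-∀
      expansion : (z ∸ s) + (t′ + Y * p) * z ≡ p ^ suc (2 * 0) * n
      expansion = begin
        (z ∸ s) + (t′ + Y * p) * z   ≡⟨ regroup′ (z ∸ s) t′ Y p z ⟩
        ((z ∸ s) + t′ * z) + p * (Y * z) ≡⟨ cong (_+ p * (Y * z)) low ⟩
        p * s + p * (Y * z)          ≡⟨ sym (*-distribˡ-+ p s (Y * z)) ⟩
        p * (s + Y * z)              ≡⟨ cong (p *_) n≡ ⟩
        p * n                        ≡⟨ cong (_* n) (sym (*-identityʳ p)) ⟩
        p ^ suc (2 * 0) * n          ∎
        where regroup′ : ∀ a t Y p z → a + (t + Y * p) * z ≡ (a + t * z) + p * (Y * z)
              regroup′ = solve-∀
    odd-power (suc k) with odd-power k
    ... | X , X≡ , dsX≡ = X * p * p + (z ∸ s) * g * q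
                        , trans (proj₁ step) (trans (cong (p * p *_) X≡) (trans (sym (*-assoc (p * p) (p ^ suc (2 * k)) n)) (cong (_* n) (sym p^[3+2k]≡))))
                        , trans (cong (_+ 1) (proj₂ step)) (trans (swap (ds X) q) (trans (cong (_+ q) dsX≡) (regroup (ds Y) (s * g) (k * q) q)))
      where
      step = times-p² (z ∸ s) X (m<n⇒0<n∸m s<z) (∸-monoʳ-< {z} {s} {0} s≥1 (<⇒≤ s<z))
      p^[3+2k]≡ : p ^ suc (2 * suc k) ≡ p * p * p ^ suc (2 * k)
      p^[3+2k]≡ = trans (cong (p ^_) (odd-suc k)) (sym (*-assoc p p _))
        where odd-suc : ∀ k → suc (2 * suc k) ≡ suc (suc (suc (2 * k)))
              odd-suc = solve-∀
      swap : ∀ a b → a + b + 1 ≡ a + 1 + b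
      swap = solve-∀
      regroup : ∀ a b c d → a + b + c + d ≡ a + b + (d + c)
      regroup = solve-∀

criterion-even : ∀ q κ k D → 1 ≤ q → q * κ + k * q ≡ D → (0 < κ ⇔ 2 * k * q < 2 * D)
criterion-even q κ k D q≥1 D≡ = mk⇔ to from
  where
  to : 0 < κ → 2 * k * q < 2 * D
  to κ>0 = subst (_< 2 * D) (sym (*-assoc 2 k q)) (*-monoʳ-< 2 (subst (k * q <_) D≡ (m<n+m (k * q) (*-mono-≤ q≥1 κ>0))))
  from : 2 * k * q < 2 * D → 0 < κ
  from 2kq<2D = n≢0⇒n>0 λ κ≡0 → <-irrefl (sym (trans (sym D≡) (cong (_+ k * q) (trans (cong (q *_) κ≡0) (*-zeroʳ q)))))
                                          (*-cancelˡ-< 2 (k * q) D (subst (_< 2 * D) (*-assoc 2 k q) 2kq<2D))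

criterion-odd : ∀ q κ k t D → 1 ≤ q → 1 ≤ t → t + t ≤ q + 2 → D + 1 ≡ q * κ + t + k * q →
                (0 < κ ⇔ (2 * k + 1 + 1) * q ≤ 2 * D)
criterion-odd q κ k t D q≥1 t≥1 2t≤q+2 D+1≡ = mk⇔ to from
  where
  2D+2≡ : 2 * D + 2 ≡ 2 * (q * κ) + (t + t) + 2 * k * q
  2D+2≡ = trans (double D) (trans (cong (2 *_) D+1≡) (expand q κ t k))
    where double : ∀ D → 2 * D + 2 ≡ 2 * (D + 1)
          double = solve-∀
          expand : ∀ q κ t k → 2 * (q * κ + t + k * q) ≡ 2 * (q * κ) + (t + t) + 2 * k * q
          expand = solve-∀
  bound≡ : (2 * k + 1 + 1) * q + 2 ≡ 2 * q + 2 + 2 * k * q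
  bound≡ = expand q k
    where expand : ∀ q k → (2 * k + 1 + 1) * q + 2 ≡ 2 * q + 2 + 2 * k * q
          expand = solve-∀
  to : 0 < κ → (2 * k + 1 + 1) * q ≤ 2 * D
  to κ>0 = +-cancelʳ-≤ 2 _ _ (begin
    (2 * k + 1 + 1) * q + 2            ≡⟨ bound≡ ⟩
    2 * q + 2 + 2 * k * q              ≤⟨ +-monoˡ-≤ (2 * k * q) (+-mono-≤ (*-monoʳ-≤ 2 (m≤m*n q κ {{>-nonZero κ>0}})) (+-mono-≤ t≥1 t≥1)) ⟩
    2 * (q * κ) + (t + t) + 2 * k * q  ≡⟨ sym 2D+2≡ ⟩
    2 * D + 2                          ∎)
    where open ≤-Reasoning
  from : (2 * k + 1 + 1) * q ≤ 2 * D → 0 < κ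
  from bound≤2D = n≢0⇒n>0 λ κ≡0 → <⇒≱ (2D<bound κ≡0) bound≤2D
    where
    open ≤-Reasoning
    2D<bound : κ ≡ 0 → 2 * D < (2 * k + 1 + 1) * q
    2D<bound κ≡0 = +-cancelʳ-< 2 _ _ (begin-strict
      2 * D + 2                          ≡⟨ 2D+2≡ ⟩
      2 * (q * κ) + (t + t) + 2 * k * q  ≡⟨ cong (λ x → 2 * x + (t + t) + 2 * k * q) (trans (cong (q *_) κ≡0) (*-zeroʳ q)) ⟩
      t + t + 2 * k * q                  ≤⟨ +-monoˡ-≤ (2 * k * q) 2t≤q+2 ⟩
      q + 2 + 2 * k * q                  <⟨ +-monoˡ-< (2 * k * q) (+-monoˡ-< 2 (subst (q <_) (sym (cong (q +_) (+-identityʳ q))) (m<m+n q q≥1))) ⟩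
      2 * q + 2 + 2 * k * q              ≡⟨ sym bound≡ ⟩
      (2 * k + 1 + 1) * q + 2            ∎)

module FibonomialValuation (q : ℕ) (q≥1 : 1 ≤ q) (pp : Prime (suc q)) (p≢2 : suc q ≢ 2)
                           (z′ : ℕ) (R : IsRankOfAppearance (suc q) (suc z′))
                           (e′ : ℕ) (νFz : IsValuation (suc q) (fib (suc z′)) (suc e′))
                           (N W : ℕ) where
  open DigitSum q q≥1
  open Valuation pp hiding (1<p)
  open FibonacciValuation q q≥1 pp p≢2 z′ R e′ νFz using (z; K; val-fibProd)

  X Y W′ : ℕ
  X = (N + W) / z
  Y = N / z
  W′ = W / z

  C>0 : 0 < fibBinom N W
  C>0 = n≢0⇒n>0 λ C≡0 → <⇒≢ (fibProd-pos (N + W)) (sym (trans (fibBinom-prod N W) (cong (_* (fibProd N * fibProd W)) C≡0)))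

  κ : ℕ
  κ = proj₁ (val-exists (fibBinom N W) C>0)

  νC : IsValuation p (fibBinom N W) κ
  νC = proj₂ (val-exists (fibBinom N W) C>0)

  p∣C⇔κ>0 : p ∣ fibBinom N W ⇔ 0 < κ
  p∣C⇔κ>0 = mk⇔ (λ p∣C → n≢0⇒n>0 λ κ≡0 → val0⇒∤ (subst (IsValuation p _) κ≡0 νC) p∣C) from
    where
    from : 0 < κ → p ∣ fibBinom N W
    from κ>0 with κ | νC
    ... | suc κ′ | νC′ = val-suc⇒∣ κ′ νC′

  valuation-identity : q * κ + ds X + K * (Y + W′) ≡ ds Y + ds W′ + K * X
  valuation-identity with val-fibProd (N + W) | val-fibProd N | val-fibProd W
  ... | E , νE , E≡ | Eₙ , νEₙ , Eₙ≡ | Eₘ , νEₘ , Eₘ≡ = begin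
    q * κ + ds X + K * (Y + W′)                        ≡⟨ cong (q * κ + ds X +_) (*-distribˡ-+ K Y W′) ⟩
    q * κ + ds X + (K * Y + K * W′)                    ≡⟨ cong₂ (λ a b → q * κ + ds X + (a + b)) (sym Eₙ≡) (sym Eₘ≡) ⟩
    q * κ + ds X + (q * Eₙ + ds Y + (q * Eₘ + ds W′))  ≡⟨ regroup q κ Eₙ Eₘ (ds X) (ds Y) (ds W′) ⟩
    q * (κ + (Eₙ + Eₘ)) + ds X + (ds Y + ds W′)        ≡⟨ cong (λ t → q * t + ds X + (ds Y + ds W′)) (sym E≡κ+Eₙ+Eₘ) ⟩
    q * E + ds X + (ds Y + ds W′)                      ≡⟨ cong (_+ (ds Y + ds W′)) E≡ ⟩
    K * X + (ds Y + ds W′)                             ≡⟨ +-comm (K * X) _ ⟩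
    ds Y + ds W′ + K * X                               ∎
    where
    open ≡-Reasoning
    E≡κ+Eₙ+Eₘ : E ≡ κ + (Eₙ + Eₘ)
    E≡κ+Eₙ+Eₘ = val-unique E _ νE (subst (λ t → IsValuation p t (κ + (Eₙ + Eₘ))) (sym (fibBinom-prod N W)) (val-mul κ _ νC (val-mul Eₙ Eₘ νEₙ νEₘ)))
    regroup : ∀ q κ a b x y w → q * κ + x + (q * a + y + (q * b + w)) ≡ q * (κ + (a + b)) + x + (y + w)
    regroup = solve-∀

  no-carry : X ≡ Y + W′ → q * κ + ds X ≡ ds Y + ds W′
  no-carry X≡ = +-cancelʳ-≡ (K * X) _ _ (trans (cong (λ t → q * κ + ds X + K * t) X≡) valuation-identity)

  -- a carry in base z forces p ∣ (N+W choose N)_F, as K ≥ 2 exceeds the one unit a carry can add to s(X)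
  carry : X ≡ suc (Y + W′) → 0 < κ
  carry X≡ = n≢0⇒n>0 λ κ≡0 → <⇒≱ (too-big κ≡0) (subst (λ t → ds t ≤ 1 + (ds Y + ds W′)) (sym X≡)
                                  (≤-trans (ds-subadditive pp 1 (Y + W′)) (+-mono-≤ (≤-reflexive ds-1) (ds-subadditive pp Y W′))))
    where
    open ≤-Reasoning
    K≥2 : 2 ≤ K
    K≥2 = +-monoˡ-≤ 1 (*-mono-≤ q≥1 (s≤s (z≤n {e′})))
    identity′ : q * κ + ds X ≡ ds Y + ds W′ + K
    identity′ = +-cancelʳ-≡ (K * (Y + W′)) _ _ (begin-equality
      q * κ + ds X + K * (Y + W′)       ≡⟨ valuation-identity ⟩
      ds Y + ds W′ + K * X              ≡⟨ cong (λ t → ds Y + ds W′ + K * t) X≡ ⟩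
      ds Y + ds W′ + K * suc (Y + W′)   ≡⟨ cong (ds Y + ds W′ +_) (*-suc K (Y + W′)) ⟩
      ds Y + ds W′ + (K + K * (Y + W′)) ≡⟨ sym (+-assoc (ds Y + ds W′) K _) ⟩
      ds Y + ds W′ + K + K * (Y + W′)   ∎)
    too-big : κ ≡ 0 → 1 + (ds Y + ds W′) < ds X
    too-big κ≡0 = begin-strict
      1 + (ds Y + ds W′)  <⟨ ≤-reflexive (+-comm 2 (ds Y + ds W′)) ⟩
      ds Y + ds W′ + 2    ≤⟨ +-monoʳ-≤ (ds Y + ds W′) K≥2 ⟩
      ds Y + ds W′ + K    ≡⟨ sym identity′ ⟩
      q * κ + ds X        ≡⟨ cong (λ t → q * t + ds X) κ≡0 ⟩
      q * 0 + ds X        ≡⟨ cong (_+ ds X) (*-zeroʳ q) ⟩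
      ds X                ∎

module Setting (q : ℕ) (q≥1 : 1 ≤ q) (pp : Prime (suc q)) (p≢2 : suc q ≢ 2) (p≡±2 : suc q % 5 ≡ 2 ⊎ suc q % 5 ≡ 3)
               (z′ : ℕ) (R : IsRankOfAppearance (suc q) (suc z′))
               (a n : ℕ) (z∤n : ¬ suc z′ ∣ n) (v : ℕ) (νn : IsValuation (suc q) n v) where
  open DigitSum q q≥1
  open Valuation pp hiding (1<p)
  open Rank pp R using (p∣Fz; rank∣)

  z : ℕ
  z = suc z′

  positive-e : Σ[ e′ ∈ ℕ ] IsValuation p (fib z) (suc e′)
  positive-e with val-exists (fib z) (fib-suc-pos z′)
  ... | zero , ν0 = ⊥-elim (val0⇒∤ ν0 p∣Fz)
  ... | suc e′ , νFz = e′ , νFz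

  z∣p+1 : z ∣ suc p
  z∣p+1 = rank∣ (suc p) (prime∣fib[1+p] pp p≢2 p≡±2)

  g : ℕ
  g = _∣_.quotient z∣p+1

  p∤z : ¬ p ∣ z
  p∤z p∣z = prime∤1 pp (∣m+n∣m⇒∣n (subst (p ∣_) (+-comm 1 p) (∣-trans p∣z z∣p+1)) ∣-refl)

  open PowerDigits q q≥1 z′ g (_∣_.equality z∣p+1) using (t-bounds; even-power; odd-power; last-digit)

  -- W = n(pᵃ − 1), so that the Fibonomial is (n + W choose n)_F
  M W : ℕ
  M = p ^ a * n
  W = M ∸ n

  instance
    pᵃ≢0 : NonZero (p ^ a)
    pᵃ≢0 = m^n≢0 p a

  n+W≡M : n + W ≡ M
  n+W≡M = m+[n∸m]≡n (m≤n*m n (p ^ a))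

  open FibonomialValuation q q≥1 pp p≢2 z′ R (proj₁ positive-e) (proj₂ positive-e) n W
    using (X; Y; W′; κ; p∣C⇔κ>0; no-carry; carry)

  p∣fibonomial⇔κ>0 : p ∣ fibonomial M n ⇔ 0 < κ
  p∣fibonomial⇔κ>0 = p∣C⇔κ>0 ⇔-∘ mk⇔ (subst (p ∣_) C≡) (subst (p ∣_) (sym C≡))
    where
    C≡ : fibonomial M n ≡ fibBinom n W
    C≡ = trans (cong (λ t → fibonomial t n) (sym n+W≡M)) (fibonomial≡fibBinom n W)

  s r w : ℕ
  s = n % z
  r = M % z
  w = W % z

  n≡ : s + Y * z ≡ n
  n≡ = sym (m≡m%n+[m/n]*n n z)

  M≡ : r + X * z ≡ M
  M≡ = begin
    M % z + X * z              ≡⟨ cong (λ t → t % z + X * z) (sym n+W≡M) ⟩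
    (n + W) % z + X * z        ≡⟨ sym (m≡m%n+[m/n]*n (n + W) z) ⟩
    n + W                      ≡⟨ n+W≡M ⟩
    M                          ∎
    where open ≡-Reasoning

  s≥1 : 1 ≤ s
  s≥1 = n≢0⇒n>0 λ s≡0 → z∤n (divides Y (trans (sym n≡) (cong (_+ Y * z) s≡0)))

  s<z : s < z
  s<z = m%n<n n z

  carry-when : r < s → X ≡ suc (Y + W′)
  carry-when r<s with add-digits z n W
  ... | inj₁ (_ , last≡ , _) = ⊥-elim (<⇒≱ r<s (subst (s ≤_) (trans (sym last≡) (cong (_% z) n+W≡M)) (m≤m+n s w)))
  ... | inj₂ (_ , X≡) = X≡

  no-carry-when : s ≤ r → X ≡ Y + W′ × r ≡ s + w
  no-carry-when s≤r with add-digits z n W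
  ... | inj₁ (_ , last≡ , X≡) = X≡ , trans (cong (_% z) (sym n+W≡M)) last≡
  ... | inj₂ (digits≡ , _) = ⊥-elim (<⇒≱ (+-monoʳ-< s (m%n<n W z)) (begin
        s + z                  ≤⟨ +-monoˡ-≤ z s≤r ⟩
        r + z                  ≡⟨ cong (λ m → m % z + z) (sym n+W≡M) ⟩
        (n + W) % z + z        ≡⟨ sym digits≡ ⟩
        s + w                  ∎))
    where open ≤-Reasoning

  A : ℕ
  A = floorDiv (n * (p ^ a ∸ 1)) (p ^ v * z)

  n[pᵃ-1]≡W : n * (p ^ a ∸ 1) ≡ W
  n[pᵃ-1]≡W = trans (*-distribˡ-∸ n (p ^ a) 1) (cong₂ _∸_ (*-comm n (p ^ a)) (*-identityʳ n))

  -- If z ∣ W then W/z = pᵛ·A, since pᵛ ∣ n ∣ W and p ∤ z; so s(A) = s(W/z).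
  ds-A-when-w≡0 : w ≡ 0 → ds A ≡ ds W′
  ds-A-when-w≡0 w≡0 = begin
      ds A             ≡⟨ cong ds A≡A′ ⟩
      ds A′            ≡⟨ sym (ds-p^ v A′) ⟩
      ds (p ^ v * A′)  ≡⟨ cong ds (trans (*-comm (p ^ v) A′) (sym W′≡)) ⟩
      ds W′            ∎
    where
    open ≡-Reasoning
    W≡W′z : W ≡ W′ * z
    W≡W′z = trans (m≡m%n+[m/n]*n W z) (cong (_+ W′ * z) w≡0)
    pᵛ∣W′ : p ^ v ∣ W′
    pᵛ∣W′ = pow-coprime p∤z v W′ (subst (p ^ v ∣_) W≡W′z (∣-trans (proj₁ νn) (subst (n ∣_) n[pᵃ-1]≡W (m∣m*n (p ^ a ∸ 1)))))
    A′ = _∣_.quotient pᵛ∣W′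
    W′≡ : W′ ≡ A′ * p ^ v
    W′≡ = _∣_.equality pᵛ∣W′
    instance
      pᵛz≢0 : NonZero (p ^ v * z)
      pᵛz≢0 = m*n≢0 (p ^ v) z {{m^n≢0 p v}}
    A≡A′ : A ≡ A′
    A≡A′ = begin
      A                                 ≡⟨ floorDiv≡/ _ (p ^ v * z) ⟩
      n * (p ^ a ∸ 1) / (p ^ v * z)      ≡⟨ cong (_/ (p ^ v * z)) (trans n[pᵃ-1]≡W (trans W≡W′z (trans (cong (_* z) W′≡) (*-assoc A′ (p ^ v) z)))) ⟩
      A′ * (p ^ v * z) / (p ^ v * z)     ≡⟨ m*n/n≡m A′ (p ^ v * z) ⟩
      A′                                ∎

  A-when-v≡0 : v ≡ 0 → A ≡ W′
  A-when-v≡0 refl = trans (cong (floorDiv (n * (p ^ a ∸ 1))) (*-identityˡ z)) (cong (_/ z) n[pᵃ-1]≡W)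

  -- t = s(p + 1)/z, with 1 ≤ t ≤ p
  t : ℕ
  t = s * g

  t≥1 : 1 ≤ t
  t≥1 = proj₁ (t-bounds s s≥1 s<z)

  -- p^{2k} ≡ 1 and p^{2k+1} ≡ −1 (mod z) determine r and the digit sum of X.
  even-digits : ∀ k → a ≡ 2 * k → r ≡ s × ds X ≡ ds Y + k * q
  even-digits k a≡2k = proj₁ same , trans (cong ds (proj₂ same)) (proj₂ (proj₂ expansion))
    where
    expansion = even-power n s Y n≡ s≥1 s<z k
    same : r ≡ s × X ≡ proj₁ expansion
    same = divmod-injective r X s _ (m%n<n M z) s<z
             (trans M≡ (trans (cong (λ e → p ^ e * n) a≡2k) (sym (proj₁ (proj₂ expansion)))))

  odd-digits : ∀ k → a ≡ 2 * k + 1 → r ≡ z ∸ s × ds X + 1 ≡ ds Y + t + k * q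
  odd-digits k a≡2k+1 = proj₁ same , trans (cong (λ x → ds x + 1) (proj₂ same)) (proj₂ (proj₂ expansion))
    where
    expansion = odd-power n s Y n≡ s≥1 s<z k
    z∸s<z : z ∸ s < z
    z∸s<z = ∸-monoʳ-< {z} {s} {0} s≥1 (<⇒≤ s<z)
    same : r ≡ z ∸ s × X ≡ proj₁ expansion
    same = divmod-injective r X (z ∸ s) _ (m%n<n M z) z∸s<z
             (trans M≡ (trans (cong (λ e → p ^ e * n) (trans a≡2k+1 (+-comm (2 * k) 1))) (sym (proj₁ (proj₂ expansion)))))

  -- 2t = (s + s)g ≤ (s + r)g = zg = p + 1 when r = z − s ≥ s
  2t≤q+2 : r ≡ z ∸ s → s ≤ r → t + t ≤ q + 2
  2t≤q+2 r≡ s≤r = begin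
    t + t          ≡⟨ sym (*-distribʳ-+ g s s) ⟩
    (s + s) * g    ≤⟨ *-monoˡ-≤ g (≤-trans (+-monoˡ-≤ s (subst (s ≤_) r≡ s≤r)) (≤-reflexive (m∸n+n≡m (<⇒≤ s<z)))) ⟩
    z * g          ≡⟨ trans (*-comm z g) (sym (_∣_.equality z∣p+1)) ⟩
    suc p          ≡⟨ +-comm 2 q ⟩
    q + 2          ∎
    where open ≤-Reasoning

  odd-identity : ∀ k → a ≡ 2 * k + 1 → s ≤ r → ds A ≡ ds W′ → ds A + 1 ≡ q * κ + t + k * q
  odd-identity k a≡ s≤r dsA≡ = +-cancelˡ-≡ (ds Y) _ _ (begin
    ds Y + (ds A + 1)                ≡⟨ cong (λ d → ds Y + (d + 1)) dsA≡ ⟩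
    ds Y + (ds W′ + 1)               ≡⟨ sym (+-assoc (ds Y) (ds W′) 1) ⟩
    ds Y + ds W′ + 1                 ≡⟨ cong (_+ 1) (sym (no-carry (proj₁ (no-carry-when s≤r)))) ⟩
    q * κ + ds X + 1                 ≡⟨ +-assoc (q * κ) (ds X) 1 ⟩
    q * κ + (ds X + 1)               ≡⟨ cong (q * κ +_) (proj₂ (odd-digits k a≡)) ⟩
    q * κ + (ds Y + t + k * q)       ≡⟨ regroup (q * κ) (ds Y) t (k * q) ⟩
    ds Y + (q * κ + t + k * q)       ∎)
    where
    open ≡-Reasoning
    regroup : ∀ a b c d → a + (b + c + d) ≡ b + (a + c + d)
    regroup = solve-∀

  p∣fibonomial-by-carry : r < s → p ∣ fibonomial M n
  p∣fibonomial-by-carry r<s = Equivalence.from p∣fibonomial⇔κ>0 (carry (carry-when r<s))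

  -- (i) a = 2k: r = s, so no carry and z ∣ W, and (p − 1)κ + kq = s(A).
  part-i : ∀ k → a ≡ 2 * k → (p ∣ fibonomial M n ⇔ a * q < 2 * ds A)
  part-i k a≡2k = subst (λ b → p ∣ fibonomial M n ⇔ b * q < 2 * ds A) (sym a≡2k)
                    (criterion-even q κ k (ds A) q≥1 κ-identity ⇔-∘ p∣fibonomial⇔κ>0)
    where
    r≡s = proj₁ (even-digits k a≡2k)
    no-carry-digits = no-carry-when (≤-reflexive (sym r≡s))
    w≡0 : w ≡ 0
    w≡0 = sym (+-cancelˡ-≡ s _ _ (trans (+-identityʳ s) (trans (sym r≡s) (proj₂ no-carry-digits))))
    κ-identity : q * κ + k * q ≡ ds A
    κ-identity = +-cancelˡ-≡ (ds Y) _ _ (begin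
      ds Y + (q * κ + k * q)   ≡⟨ regroup (ds Y) (q * κ) (k * q) ⟩
      q * κ + (ds Y + k * q)   ≡⟨ cong (q * κ +_) (sym (proj₂ (even-digits k a≡2k))) ⟩
      q * κ + ds X             ≡⟨ no-carry (proj₁ no-carry-digits) ⟩
      ds Y + ds W′             ≡⟨ cong (ds Y +_) (sym (ds-A-when-w≡0 w≡0)) ⟩
      ds Y + ds A              ∎)
      where
      open ≡-Reasoning
      regroup : ∀ a b c → a + (b + c) ≡ b + (a + c)
      regroup = solve-∀

  odd-criterion : ∀ k → a ≡ 2 * k + 1 → s ≤ r → ds A ≡ ds W′ → (p ∣ fibonomial M n ⇔ (a + 1) * q ≤ 2 * ds A)
  odd-criterion k a≡ s≤r dsA≡ = subst (λ b → p ∣ fibonomial M n ⇔ (b + 1) * q ≤ 2 * ds A) (sym a≡)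
    (criterion-odd q κ k t (ds A) q≥1 t≥1 (2t≤q+2 (proj₁ (odd-digits k a≡)) s≤r) (odd-identity k a≡ s≤r dsA≡) ⇔-∘ p∣fibonomial⇔κ>0)

  -- For p ∣ n and s < r there is no carry in base z, but the last base-p
  -- digit of X is below that of Y: by last-digit, X mod p + rg = p = Y mod p + t
  -- with t = sg < rg. So W′ carries into Y in base p and s(X) < s(Y) + s(W′).
  p∣fibonomial-by-low-digit : ∀ k → a ≡ 2 * k + 1 → p ∣ n → s < r → p ∣ fibonomial M n
  p∣fibonomial-by-low-digit k a≡ p∣n s<r = Equivalence.from p∣fibonomial⇔κ>0 (n≢0⇒n>0 κ≢0)
    where
    X≡Y+W′ = proj₁ (no-carry-when (<⇒≤ s<r))
    r≥1 : 1 ≤ r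
    r≥1 = ≤-trans s≥1 (<⇒≤ s<r)
    r<z : r < z
    r<z = m%n<n M z
    g≢0 : NonZero g
    g≢0 = >-nonZero (n≢0⇒n>0 λ g≡0 → <⇒≢ t≥1 (sym (trans (cong (s *_) g≡0) (*-zeroʳ s))))
    t<rg : t < r * g
    t<rg = *-monoˡ-< g {{g≢0}} s<r
    Y-digit : s * g + Y % p ≡ p
    Y-digit = last-digit s Y s≥1 s<z (subst (p ∣_) (sym n≡) p∣n)
    X-digit : r * g + X % p ≡ p
    X-digit = last-digit r X r≥1 r<z (subst (p ∣_) (sym M≡) (∣n⇒∣m*n (p ^ a) p∣n))
    X%p<Y%p : (Y + W′) % p < Y % p
    X%p<Y%p = subst (λ x → x % p < Y % p) X≡Y+W′ (+-cancelʳ-< t (X % p) (Y % p) (begin-strict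
      X % p + t        <⟨ +-monoʳ-< (X % p) t<rg ⟩
      X % p + r * g    ≡⟨ trans (+-comm (X % p) (r * g)) (trans X-digit (sym Y-digit)) ⟩
      t + Y % p        ≡⟨ +-comm t (Y % p) ⟩
      Y % p + t        ∎))
      where open ≤-Reasoning
    κ≢0 : κ ≢ 0
    κ≢0 κ≡0 = <-irrefl no-drop (ds-carry pp Y W′ X%p<Y%p)
      where
      no-drop : ds (Y + W′) ≡ ds Y + ds W′
      no-drop = trans (cong ds (sym X≡Y+W′)) (trans (cong (_+ ds X) (sym (trans (cong (q *_) κ≡0) (*-zeroʳ q)))) (no-carry X≡Y+W′))

  -- (ii) a odd, p ∤ n: carry if r < s, and A = W/z otherwise.
  part-ii : ∀ k → a ≡ 2 * k + 1 → ¬ p ∣ n →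
            (r < s → p ∣ fibonomial M n) × (s ≤ r → (p ∣ fibonomial M n ⇔ (a + 1) * q ≤ 2 * ds A))
  part-ii k a≡ p∤n = p∣fibonomial-by-carry , λ s≤r → odd-criterion k a≡ s≤r (cong ds (A-when-v≡0 v≡0))
    where
    v≡0 : v ≡ 0
    v≡0 = val-unique v 0 νn (val0 p∤n)

  -- (iii) a odd, p ∣ n: a carry in base z if r < s or in base p if r > s;
  -- for r = s the addition n + W does not carry and z ∣ W.
  part-iii : ∀ k → a ≡ 2 * k + 1 → p ∣ n →
             (r ≢ s → p ∣ fibonomial M n) × (r ≡ s → (p ∣ fibonomial M n ⇔ (a + 1) * q ≤ 2 * ds A))
  part-iii k a≡ p∣n = r≢s , r≡s
    where
    r≢s : r ≢ s → p ∣ fibonomial M n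
    r≢s r≢s with <-cmp r s
    ... | tri< r<s _ _ = p∣fibonomial-by-carry r<s
    ... | tri≈ _ r≡s _ = ⊥-elim (r≢s r≡s)
    ... | tri> _ _ s<r = p∣fibonomial-by-low-digit k a≡ p∣n s<r
    r≡s : r ≡ s → (p ∣ fibonomial M n ⇔ (a + 1) * q ≤ 2 * ds A)
    r≡s r≡s = odd-criterion k a≡ (≤-reflexive (sym r≡s)) (ds-A-when-w≡0 w≡0)
      where
      w≡0 : w ≡ 0
      w≡0 = sym (+-cancelˡ-≡ s _ _ (trans (+-identityʳ s) (trans (sym r≡s) (proj₂ (no-carry-when (≤-reflexive (sym r≡s)))))))

corollary14 : (p : ℕ) → Prime p → p ≢ 2 → p ≢ 5 →
    (modN p 5 ≡ 2 ⊎ modN p 5 ≡ 3) →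
    (zp : ℕ) → IsRankOfAppearance p zp →
    (a n : ℕ) → 0 < a → 0 < n → ¬ (zp ∣ n) →
    (v : ℕ) → IsValuation p n v →
    let r = modN (p ^ a * n) zp
        s = modN n zp
        A = floorDiv (n * (p ^ a ∸ 1)) (p ^ v * zp)
        C = fibonomial (p ^ a * n) n
    in ((k : ℕ) → a ≡ 2 * k →
          (p ∣ C ⇔ a * (p ∸ 1) < 2 * sp p A))
     × ((k : ℕ) → a ≡ 2 * k + 1 → ¬ (p ∣ n) →
          (r < s → p ∣ C)
          × (s ≤ r → (p ∣ C ⇔ (a + 1) * (p ∸ 1) ≤ 2 * sp p A)))
     × ((k : ℕ) → a ≡ 2 * k + 1 → p ∣ n →
          (r ≢ s → p ∣ C)
          × (r ≡ s → (p ∣ C ⇔ (a + 1) * (p ∸ 1) ≤ 2 * sp p A)))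
corollary14 0 pp _ _ _ _ _ _ _ _ _ _ _ _ with () ← nonTrivial⇒n>1 0 {{prime⇒nonTrivial pp}}
corollary14 1 pp _ _ _ _ _ _ _ _ _ _ _ _ with s≤s () ← nonTrivial⇒n>1 1 {{prime⇒nonTrivial pp}}
corollary14 (suc (suc q′)) _ _ _ _ 0 R _ _ _ _ _ _ _ with () ← proj₁ R
corollary14 (suc (suc q′)) pp p≢2 _ p≡±2 (suc z′) R a n _ _ z∤n v νn = part-i , part-ii , part-iii
  where open Setting (suc q′) (s≤s z≤n) pp p≢2 p≡±2 z′ R a n z∤n v νn
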